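{- Let $q$ be a rational number with denominator $d\ge2$, written $q=u+\frac{\alpha}{d}$ with $u\in\{0,-1\}$, $\alpha\in\mathbb{Z}$, $1\le\alpha<d$, $\gcd(\alpha,d)=1$. Let $n,k$ be integers with $n\ge2k>0$ and let $a_0,\dots,a_n$ be integers with $a_0a_n\neq0$ and $P(a_0a_n)\le d$. Suppose $$P\big((\alpha+d(u+n-k+1))\cdots(\alpha+d(u+n))\big)>d(u+k+1).$$ Then $G_q(x)$ does not have a factor (over $\mathbb{Q}$) of degree $k$, and $G_q(x^d)$ does not have a factor of degree in $\{dk,dk-1,\dots,dk-d+1\}$.
   Context: For a positive integer $n$ and integers $a_0,\dots,a_n$, with $q=u+\frac{\alpha}{d}$ as stated, $$G_q(x)=\sum_{j=0}^n a_j x^j\prod_{i=j+1}^n(\alpha+(u+i)d)$$ (empty product $=1$). For a nonzero integer $m$, $P(m)$ denotes the greatest prime factor of $m$, with $P(\pm1)=1$. -}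

module Defs where

open import Data.Nat as ℕ using (ℕ; zero; suc; _∸_)
open import Data.Nat.Primality using (prime?)
open import Data.Nat.Divisibility using (_∣?_)
open import Data.Integer as ℤ using (ℤ; +_; ∣_∣)
open import Data.Rational as ℚ using (ℚ; 0ℚ)
open import Data.List using (List; []; _∷_; map; upTo; concatMap; replicate)
open import Data.Product using (Σ; _×_; ∃)
open import Relation.Nullary using (¬_; yes; no)
open import Relation.Binary.PropositionalEquality using (_≡_; _≢_)

-- Greatest prime factor P(m) of an integer m (with P(±1) = 1).
-- gpfBelow m i = largest prime p ≤ i with p ∣ m, or 1 if none.

gpfBelow : ℕ → ℕ → ℕ
gpfBelow m zero = 1
gpfBelow m (suc i) with prime? (suc i) | suc i ∣? m
... | yes _ | yes _ = suc i
... | _     | _     = gpfBelow m i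

P : ℤ → ℕ
P m = gpfBelow ∣ m ∣ ∣ m ∣

prodFrom : (ℕ → ℤ) → ℕ → ℕ → ℤ
prodFrom f lo zero        = + 1
prodFrom f lo (suc count) = f lo ℤ.* prodFrom f (suc lo) count

-- ∏_{i = lo}^{hi} f i   (empty product = 1 when lo > hi)
prodRange : (ℕ → ℤ) → ℕ → ℕ → ℤ
prodRange f lo hi = prodFrom f lo (suc hi ∸ lo)

-- Polynomials over ℚ as coefficient lists (constant term first).
-- Trailing zeros are allowed; polynomials are compared by coefficients.

Poly : Set
Poly = List ℚ

coeff : Poly → ℕ → ℚ
coeff []       _       = 0ℚ
coeff (c ∷ p)  zero    = c
coeff (c ∷ p)  (suc i) = coeff p i

_+ₚ_ : Poly → Poly → Poly
[]      +ₚ q       = q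
(a ∷ p) +ₚ []      = a ∷ p
(a ∷ p) +ₚ (b ∷ q) = (a ℚ.+ b) ∷ (p +ₚ q)

_*ₚ_ : Poly → Poly → Poly
[]      *ₚ q = []
(a ∷ p) *ₚ q = map (a ℚ.*_) q +ₚ (0ℚ ∷ (p *ₚ q))

_≈ₚ_ : Poly → Poly → Set
p ≈ₚ q = ∀ i → coeff p i ≡ coeff q i

HasDegree : Poly → ℕ → Set
HasDegree p k = (coeff p k ≢ 0ℚ) × (∀ i → k ℕ.< i → coeff p i ≡ 0ℚ)

HasFactorOfDegree : Poly → ℕ → Set
HasFactorOfDegree f k = Σ Poly λ g → Σ Poly λ h → HasDegree g k × ((g *ₚ h) ≈ₚ f)

substXPow : ℕ → Poly → Poly
substXPow d = concatMap (λ c → c ∷ replicate (d ∸ 1) 0ℚ)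

-- G_q(x) = Σ_{j=0}^n a_j x^j ∏_{i=j+1}^n (α + (u+i) d), for q = u + α/d.

GqCoeff : (u : ℤ) (α d n : ℕ) (a : ℕ → ℤ) → ℕ → ℤ
GqCoeff u α d n a j =
  a j ℤ.* prodRange (λ i → + α ℤ.+ (u ℤ.+ + i) ℤ.* + d) (suc j) n

Gq : (u : ℤ) (α d n : ℕ) (a : ℕ → ℤ) → Poly
Gq u α d n a = map (λ j → GqCoeff u α d n a j ℚ./ 1) (upTo (suc n))

{-# OPTIONS --safe #-}
-- Let p be the greatest prime factor of T (n − k + 1) ⋯ T n, where T i = α + d(u + i).  Then
-- p > d(u + k + 1) ≥ d ≥ P(a₀aₙ), so p ∤ a₀aₙ, and p divides some T i₀ with n − k < i₀ ≤ n.
-- Consequently, for the coefficients cⱼ of G_q, p divides cⱼ for j < i₀, p ∤ cₙ, and a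
-- Legendre-type bound on ν_p(T 1 ⋯ T j) gives k·(ν c₀ − ν cⱼ) < j.  Now let F = g·h be G_q or
-- G_q(x^d) (e = 1 or e = d), with deg g = m ∈ (e k − e, e k].  Over a factorisation, the minimum of
-- a weight A·ν(coefficient) + B·index is additive and first attained at the sum of the first
-- indices where the factors attain theirs.  Taking the weight "−index" bounds deg h; taking ν
-- shows that g attains its least valuation first at some 1 ≤ a ≤ m, so ν gₐ < ν g₀; taking the
-- steep weight Aₙ·ν + n·index with Aₙ = n e k + 1 shows that g attains its least weight at 0,
-- because c₀ does for F.  These are incompatible since Aₙ > n·m.
module Submission where

open import Data.Nat as ℕ using (ℕ)
open import Data.Nat.Primality using (Prime)
open import Data.Integer as ℤ using (ℤ; +_)
open import Data.Rational as ℚ using (ℚ)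
open import Data.Product using (Σ; _×_)
open import Data.Sum using (_⊎_)
open import Relation.Binary.PropositionalEquality using (_≡_)
open import Defs

module NatValuation (p : ℕ) (p-prime : Prime p) where

  open import Data.Nat as ℕ using (ℕ; zero; suc; _≤_; _<_; _∸_; _^_; NonZero; s≤s)
  open import Data.Nat.Properties
  open import Data.Nat.Divisibility
  open import Data.Nat.Primality
  open import Data.Product using (Σ; _×_; _,_)
  open import Data.Sum using (inj₁; inj₂)
  open import Data.Empty using (⊥-elim)
  open import Relation.Nullary using (¬_; yes; no)
  open import Relation.Binary.PropositionalEquality
  open import Data.Nat.Tactic.RingSolver using (solve-∀)

  instance
    p-nonZero : NonZero p
    p-nonZero = prime⇒nonZero p-prime

  p≥2 : 2 ≤ p
  p≥2 = ℕ.nonTrivial⇒n>1 p {{prime⇒nonTrivial p-prime}}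

  p∤1 : ¬ p ∣ 1
  p∤1 p∣1 with ∣1⇒≡1 p∣1 | p≥2
  ... | refl | s≤s ()

  Factorisation : ℕ → ℕ → ℕ → Set
  Factorisation n e m = (n ≡ p ^ e ℕ.* m) × ¬ (p ∣ m)

  private
    -- the first argument is fuel; n itself always suffices
    ν-fuel : ℕ → ℕ → ℕ
    ν-fuel zero    _       = 0
    ν-fuel (suc f) zero    = 0
    ν-fuel (suc f) (suc n) with p ∣? suc n
    ... | yes (divides q _) = suc (ν-fuel f q)
    ... | no _              = 0

    ν-fuel-factorisation : ∀ f n → n ≤ f → n ≢ 0 → Σ ℕ (Factorisation n (ν-fuel f n))
    ν-fuel-factorisation _       zero    _  n≢0 = ⊥-elim (n≢0 refl)
    ν-fuel-factorisation (suc f) (suc n) le _ with p ∣? suc n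
    ... | no p∤n = suc n , sym (*-identityˡ (suc n)) , p∤n
    ... | yes (divides zero ())
    ... | yes (divides (suc q) n≡qp)
      with ν-fuel-factorisation f (suc q) (≤-pred (≤-trans q<n le)) (λ ())
      where
        q<n : suc q < suc n
        q<n = ≤-trans (m<m*n (suc q) p p≥2) (≤-reflexive (sym n≡qp))
    ... | m , q≡ , p∤m = m , trans n≡qp (trans (cong (ℕ._* p) q≡) (shuffle (p ^ ν-fuel f (suc q)) m p)) , p∤m
      where
        shuffle : ∀ a m p → a ℕ.* m ℕ.* p ≡ p ℕ.* a ℕ.* m
        shuffle = solve-∀

  abstract
    ν : ℕ → ℕ
    ν n = ν-fuel n n

    ν-factorisation : ∀ n → n ≢ 0 → Σ ℕ (Factorisation n (ν n))
    ν-factorisation n = ν-fuel-factorisation n n ≤-refl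

  private
    p*a*b≡a*b*p : ∀ a b → p ℕ.* a ℕ.* b ≡ a ℕ.* b ℕ.* p
    p*a*b≡a*b*p a b = shuffle a b p
      where
        shuffle : ∀ a b p → p ℕ.* a ℕ.* b ≡ a ℕ.* b ℕ.* p
        shuffle = solve-∀

  factorisation-unique : ∀ e e′ m m′ → p ^ e ℕ.* m ≡ p ^ e′ ℕ.* m′ → ¬ p ∣ m → ¬ p ∣ m′ → e ≡ e′
  factorisation-unique zero    zero     m m′ eq p∤m p∤m′ = refl
  factorisation-unique zero    (suc e′) m m′ eq p∤m p∤m′ =
    ⊥-elim (p∤m (divides (p ^ e′ ℕ.* m′) (trans (sym (*-identityˡ m)) (trans eq (p*a*b≡a*b*p (p ^ e′) m′)))))
  factorisation-unique (suc e) zero     m m′ eq p∤m p∤m′ =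
    ⊥-elim (p∤m′ (divides (p ^ e ℕ.* m) (trans (sym (*-identityˡ m′)) (trans (sym eq) (p*a*b≡a*b*p (p ^ e) m)))))
  factorisation-unique (suc e) (suc e′) m m′ eq p∤m p∤m′ =
    cong suc (factorisation-unique e e′ m m′
      (*-cancelˡ-≡ _ _ p (trans (sym (*-assoc p (p ^ e) m)) (trans eq (*-assoc p (p ^ e′) m′)))) p∤m p∤m′)

  factorisation⇒ν≡ : ∀ n e m → Factorisation n e m → ν n ≡ e
  factorisation⇒ν≡ n e m (n≡ , p∤m) with n ℕ.≟ 0
  ... | yes refl = ⊥-elim (p∤m (subst (p ∣_) (sym m≡0) (p ∣0)))
    where
      m≡0 : m ≡ 0
      m≡0 with m*n≡0⇒m≡0∨n≡0 (p ^ e) (sym n≡)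
      ... | inj₁ pᵉ≡0 = ⊥-elim (ℕ.≢-nonZero⁻¹ (p ^ e) {{m^n≢0 p e}} pᵉ≡0)
      ... | inj₂ m≡0  = m≡0
  ... | no n≢0 with ν-factorisation n n≢0
  ... | m′ , n≡′ , p∤m′ = factorisation-unique (ν n) e m′ m (trans (sym n≡′) n≡) p∤m′ p∤m

  ν-* : ∀ a b → a ≢ 0 → b ≢ 0 → ν (a ℕ.* b) ≡ ν a ℕ.+ ν b
  ν-* a b a≢0 b≢0 with ν-factorisation a a≢0 | ν-factorisation b b≢0
  ... | ma , a≡ , p∤ma | mb , b≡ , p∤mb =
    factorisation⇒ν≡ (a ℕ.* b) (ν a ℕ.+ ν b) (ma ℕ.* mb) (ab≡ , p∤mamb)
    where
      shuffle : ∀ x y u v → x ℕ.* u ℕ.* (y ℕ.* v) ≡ x ℕ.* y ℕ.* (u ℕ.* v)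
      shuffle = solve-∀
      ab≡ : a ℕ.* b ≡ p ^ (ν a ℕ.+ ν b) ℕ.* (ma ℕ.* mb)
      ab≡ = trans (cong₂ ℕ._*_ a≡ b≡)
              (trans (shuffle (p ^ ν a) (p ^ ν b) ma mb)
                     (cong (ℕ._* (ma ℕ.* mb)) (sym (^-distribˡ-+-* p (ν a) (ν b)))))
      p∤mamb : ¬ p ∣ ma ℕ.* mb
      p∤mamb p∣ with euclidsLemma ma mb p-prime p∣
      ... | inj₁ p∣ma = p∤ma p∣ma
      ... | inj₂ p∣mb = p∤mb p∣mb

  p^-monoʳ-∣ : ∀ {c e} → c ≤ e → p ^ c ∣ p ^ e
  p^-monoʳ-∣ {c} {e} c≤e =
    divides (p ^ (e ∸ c)) (trans (cong (p ^_) (sym (m∸n+n≡m c≤e))) (^-distribˡ-+-* p (e ∸ c) c))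

  p^ν∣n : ∀ n → p ^ ν n ∣ n
  p^ν∣n n with n ℕ.≟ 0
  ... | yes refl = divides 0 refl
  ... | no n≢0 with ν-factorisation n n≢0
  ... | m , n≡ , _ = divides m (trans n≡ (*-comm (p ^ ν n) m))

  p^c∣n⇒c≤ν : ∀ n c → n ≢ 0 → p ^ c ∣ n → c ≤ ν n
  p^c∣n⇒c≤ν n c n≢0 pᶜ∣n with ν-factorisation n n≢0
  ... | m , n≡ , p∤m with c ℕ.≤? ν n
  ... | yes c≤ν = c≤ν
  ... | no c≰ν = ⊥-elim (p∤m (*-cancelˡ-∣ (p ^ ν n) {{m^n≢0 p (ν n)}} pᵛp∣pᵛm))
    where
      p^1+ν∣n : p ^ suc (ν n) ∣ n
      p^1+ν∣n = ∣-trans (p^-monoʳ-∣ (≰⇒> c≰ν)) pᶜ∣n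
      pᵛp∣pᵛm : p ^ ν n ℕ.* p ∣ p ^ ν n ℕ.* m
      pᵛp∣pᵛm = subst₂ _∣_ (*-comm p (p ^ ν n)) n≡ p^1+ν∣n

  p∣n⇒1≤ν : ∀ n → n ≢ 0 → p ∣ n → 1 ≤ ν n
  p∣n⇒1≤ν n n≢0 p∣n = p^c∣n⇒c≤ν n 1 n≢0 (subst (_∣ n) (sym (*-identityʳ p)) p∣n)

  ν-1 : ν 1 ≡ 0
  ν-1 = factorisation⇒ν≡ 1 0 1 (refl , p∤1)

  ν-p : ν p ≡ 1
  ν-p = factorisation⇒ν≡ p 1 1 (sym (trans (*-identityʳ (p ^ 1)) (*-identityʳ p)) , p∤1)

  p∤n⇒ν≡0 : ∀ n → ¬ p ∣ n → ν n ≡ 0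
  p∤n⇒ν≡0 n p∤n = factorisation⇒ν≡ n 0 n (sym (*-identityˡ n) , p∤n)

module IntValuation (p : ℕ) (p-prime : Prime p) where

  open import Data.Nat as ℕ using (suc; _^_)
  import Data.Nat.Properties as ℕP
  import Data.Nat.Divisibility as ℕD
  open import Data.Integer as ℤ using (ℤ; +_; ∣_∣; 0ℤ)
  open import Data.Integer.Properties using (abs-*; ∣i∣≡0⇒i≡0)
  open import Data.Integer.Divisibility using (_∣_)
  import Data.Integer.Divisibility.Signed as Signed
  open import Data.Product using (_×_; _,_)
  open import Relation.Nullary using (¬_)
  open import Relation.Binary.PropositionalEquality
  open NatValuation p p-prime public

  νℤ : ℤ → ℕ
  νℤ z = ν ∣ z ∣

  ∣∣≢0 : ∀ {a} → a ≢ 0ℤ → ∣ a ∣ ≢ 0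
  ∣∣≢0 a≢0 ∣a∣≡0 = a≢0 (∣i∣≡0⇒i≡0 ∣a∣≡0)

  νℤ-* : ∀ a b → a ≢ 0ℤ → b ≢ 0ℤ → νℤ (a ℤ.* b) ≡ νℤ a ℕ.+ νℤ b
  νℤ-* a b a≢0 b≢0 = trans (cong ν (abs-* a b)) (ν-* ∣ a ∣ ∣ b ∣ (∣∣≢0 a≢0) (∣∣≢0 b≢0))

  private
    p^_∣_ : ℕ → ℤ → Set
    p^ c ∣ a = + (p ^ c) ∣ a

    c≤ν⇒p^c∣ : ∀ c a → c ℕ.≤ νℤ a → p^ c ∣ a
    c≤ν⇒p^c∣ c a c≤ν = ℕD.∣-trans (p^-monoʳ-∣ {c} {νℤ a} c≤ν) (p^ν∣n ∣ a ∣)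

    p^∣-+ : ∀ c a b → p^ c ∣ a → p^ c ∣ b → p^ c ∣ (a ℤ.+ b)
    p^∣-+ c a b ∣a ∣b = Signed.∣⇒∣ᵤ {k = + (p ^ c)} {i = a ℤ.+ b}
      (Signed.∣m∣n⇒∣m+n (Signed.∣ᵤ⇒∣ {k = + (p ^ c)} {i = a} ∣a) (Signed.∣ᵤ⇒∣ {k = + (p ^ c)} {i = b} ∣b))

    p^∣-+⁻ : ∀ c a b → p^ c ∣ (a ℤ.+ b) → p^ c ∣ b → p^ c ∣ a
    p^∣-+⁻ c a b ∣a+b ∣b = Signed.∣⇒∣ᵤ {k = + (p ^ c)} {i = a}
      (Signed.∣m+n∣n⇒∣m (Signed.∣ᵤ⇒∣ {k = + (p ^ c)} {i = a ℤ.+ b} ∣a+b) (Signed.∣ᵤ⇒∣ {k = + (p ^ c)} {i = b} ∣b))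

  νℤ-+-≥ : ∀ c a b → a ℤ.+ b ≢ 0ℤ → c ℕ.≤ νℤ a → c ℕ.≤ νℤ b → c ℕ.≤ νℤ (a ℤ.+ b)
  νℤ-+-≥ c a b a+b≢0 c≤a c≤b =
    p^c∣n⇒c≤ν ∣ a ℤ.+ b ∣ c (∣∣≢0 a+b≢0) (p^∣-+ c a b (c≤ν⇒p^c∣ c a c≤a) (c≤ν⇒p^c∣ c b c≤b))

  νℤ-+-< : ∀ a b → a ≢ 0ℤ → νℤ a ℕ.< νℤ b → (a ℤ.+ b ≢ 0ℤ) × (νℤ (a ℤ.+ b) ≡ νℤ a)
  νℤ-+-< a b a≢0 a<b = a+b≢0 , ℕP.≤-antisym (ℕP.≮⇒≥ (λ a<a+b → ¬p^1+ν∣a+b (c≤ν⇒p^c∣ (suc (νℤ a)) (a ℤ.+ b) a<a+b))) ν≤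
    where
      ¬p^1+ν∣a+b : ¬ p^ suc (νℤ a) ∣ (a ℤ.+ b)
      ¬p^1+ν∣a+b ∣a+b = ℕP.<⇒≱ (ℕP.n<1+n (νℤ a))
        (p^c∣n⇒c≤ν ∣ a ∣ (suc (νℤ a)) (∣∣≢0 a≢0) (p^∣-+⁻ (suc (νℤ a)) a b ∣a+b (c≤ν⇒p^c∣ (suc (νℤ a)) b a<b)))
      a+b≢0 : a ℤ.+ b ≢ 0ℤ
      a+b≢0 a+b≡0 = ¬p^1+ν∣a+b (subst (λ x → p^ suc (νℤ a) ∣ x) (sym a+b≡0) (ℕD.divides 0 refl))
      ν≤ : νℤ a ℕ.≤ νℤ (a ℤ.+ b)
      ν≤ = νℤ-+-≥ (νℤ a) a b a+b≢0 ℕP.≤-refl (ℕP.<⇒≤ a<b)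

module RatValuation (p : ℕ) (p-prime : Prime p) where

  open import Data.Nat as ℕ using (suc)
  import Data.Nat.Properties as ℕP
  open import Data.Integer as ℤ using (ℤ; +_; _≤_; _<_; 0ℤ; +≤+)
  open import Data.Integer.Properties
  open import Data.Rational as ℚ using (ℚ; mkℚ; ↥_)
  import Data.Rational.Properties as ℚP
  open import Data.Rational.Unnormalised as ℚᵘ using (ℚᵘ; mkℚᵘ; *≡*)
  import Data.Rational.Unnormalised.Properties as ℚᵘP
  open import Data.Product using (_×_; _,_; proj₁; proj₂)
  open import Data.Sum using (inj₁; inj₂; [_,_]′)
  open import Relation.Binary.PropositionalEquality
  import Data.Integer.Tactic.RingSolver as ℤSolver
  open import Data.Nat.Tactic.RingSolver using (solve-∀)
  open IntValuation p p-prime public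

  NZ : ℚ → Set
  NZ x = ↥ x ≢ 0ℤ

  νᵘ : ℚᵘ → ℤ
  νᵘ q = + νℤ (ℚᵘ.↥ q) ℤ.- + ν (ℚᵘ.↧ₙ q)

  opaque
    νℚ : ℚ → ℤ
    νℚ x = νᵘ (ℚ.toℚᵘ x)

    νℚ-toℚᵘ : ∀ x → νℚ x ≡ νᵘ (ℚ.toℚᵘ x)
    νℚ-toℚᵘ x = refl

  private
    ↥-toℚᵘ : ∀ x → ℚᵘ.↥ (ℚ.toℚᵘ x) ≡ ↥ x
    ↥-toℚᵘ (mkℚ _ _ _) = refl

    -- the hypothesis has both sides moved so that no truncated subtraction occurs
    +a-+b≡+c-+d : ∀ a b c d → a ℕ.+ d ≡ c ℕ.+ b → + a ℤ.- + b ≡ + c ℤ.- + d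
    +a-+b≡+c-+d a b c d eq = begin
      + a ℤ.- + b                 ≡⟨ add-sub (+ a) (+ b) (+ d) ⟩
      + a ℤ.+ + d ℤ.- + b ℤ.- + d ≡⟨ cong (λ z → z ℤ.- + b ℤ.- + d) (trans (sym (pos-+ a d)) (trans (cong +_ eq) (pos-+ c b))) ⟩
      + c ℤ.+ + b ℤ.- + b ℤ.- + d ≡⟨ cancel (+ c) (+ b) (+ d) ⟩
      + c ℤ.- + d                 ∎
      where
        open ≡-Reasoning
        add-sub : ∀ a b d → a ℤ.- b ≡ a ℤ.+ d ℤ.- b ℤ.- d
        add-sub = ℤSolver.solve-∀
        cancel : ∀ c b d → c ℤ.+ b ℤ.- b ℤ.- d ≡ c ℤ.- d
        cancel = ℤSolver.solve-∀

    +[a+c]-+[b+c]≡+a-+b : ∀ a b c → + (a ℕ.+ c) ℤ.- + (b ℕ.+ c) ≡ + a ℤ.- + b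
    +[a+c]-+[b+c]≡+a-+b a b c = +a-+b≡+c-+d (a ℕ.+ c) (b ℕ.+ c) a b (solve a b c)
      where
        solve : ∀ a b c → a ℕ.+ c ℕ.+ b ≡ a ℕ.+ (b ℕ.+ c)
        solve = solve-∀

    +[a+b]-+[b+c]≡+a-+c : ∀ a b c → + (a ℕ.+ b) ℤ.- + (b ℕ.+ c) ≡ + a ℤ.- + c
    +[a+b]-+[b+c]≡+a-+c a b c = +a-+b≡+c-+d (a ℕ.+ b) (b ℕ.+ c) a c (solve a b c)
      where
        solve : ∀ a b c → a ℕ.+ b ℕ.+ c ≡ a ℕ.+ (b ℕ.+ c)
        solve = solve-∀

    ↥ᵘ≢0 : ∀ x → NZ x → ℚᵘ.↥ (ℚ.toℚᵘ x) ≢ 0ℤ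
    ↥ᵘ≢0 x x≢0 eq = x≢0 (trans (sym (↥-toℚᵘ x)) eq)

  νᵘ-cong : ∀ q r → q ℚᵘ.≃ r → ℚᵘ.↥ q ≢ 0ℤ → (ℚᵘ.↥ r ≢ 0ℤ) × (νᵘ q ≡ νᵘ r)
  νᵘ-cong (mkℚᵘ n d) (mkℚᵘ m e) (*≡* eq) n≢0 = m≢0 , +a-+b≡+c-+d (νℤ n) (ν (suc d)) (νℤ m) (ν (suc e)) ν-eq
    where
      m≢0 : m ≢ 0ℤ
      m≢0 refl with i*j≡0⇒i≡0∨j≡0 n {+ suc e} eq
      ... | inj₁ n≡0 = n≢0 n≡0
      ... | inj₂ ()
      ν-eq : νℤ n ℕ.+ ν (suc e) ≡ νℤ m ℕ.+ ν (suc d)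
      ν-eq = trans (sym (νℤ-* n (+ suc e) n≢0 (λ ()))) (trans (cong νℤ eq) (νℤ-* m (+ suc d) m≢0 (λ ())))

  νℚ-* : ∀ x y → NZ x → NZ y → NZ (x ℚ.* y) × (νℚ (x ℚ.* y) ≡ νℚ x ℤ.+ νℚ y)
  νℚ-* x@(mkℚ n d _) y@(mkℚ m e _) x≢0 y≢0
    with νᵘ-cong _ _ (ℚᵘP.≃-sym (ℚP.toℚᵘ-homo-* x y)) nm≢0
    where
      nm≢0 : n ℤ.* m ≢ 0ℤ
      nm≢0 nm≡0 with i*j≡0⇒i≡0∨j≡0 n nm≡0
      ... | inj₁ n≡0 = x≢0 n≡0
      ... | inj₂ m≡0 = y≢0 m≡0
  ... | xy≢0 , νxy = (λ eq → xy≢0 (trans (↥-toℚᵘ (x ℚ.* y)) eq)) , (begin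
    νℚ (x ℚ.* y)                                           ≡⟨ νℚ-toℚᵘ (x ℚ.* y) ⟩
    νᵘ (ℚ.toℚᵘ (x ℚ.* y))                                  ≡⟨ sym νxy ⟩
    + νℤ (n ℤ.* m) ℤ.- + ν (suc d ℕ.* suc e)               ≡⟨ cong₂ (λ a b → + a ℤ.- + b) (νℤ-* n m x≢0 y≢0) (ν-* (suc d) (suc e) (λ ()) (λ ())) ⟩
    + (νℤ n ℕ.+ νℤ m) ℤ.- + (ν (suc d) ℕ.+ ν (suc e))      ≡⟨ cong₂ ℤ._-_ (pos-+ (νℤ n) (νℤ m)) (pos-+ (ν (suc d)) (ν (suc e))) ⟩
    + νℤ n ℤ.+ + νℤ m ℤ.- (+ ν (suc d) ℤ.+ + ν (suc e))    ≡⟨ regroup (+ νℤ n) (+ νℤ m) (+ ν (suc d)) (+ ν (suc e)) ⟩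
    νᵘ (ℚ.toℚᵘ x) ℤ.+ νᵘ (ℚ.toℚᵘ y)                        ≡⟨ sym (cong₂ ℤ._+_ (νℚ-toℚᵘ x) (νℚ-toℚᵘ y)) ⟩
    νℚ x ℤ.+ νℚ y                                          ∎)
    where
      open ≡-Reasoning
      regroup : ∀ a b c d → a ℤ.+ b ℤ.- (c ℤ.+ d) ≡ a ℤ.- c ℤ.+ (b ℤ.- d)
      regroup = ℤSolver.solve-∀

  -- On a common denominator νᵘ is a difference νℤ(numerator) − ν(denominator), and the
  -- numerator of a sum is the sum of the cross products n·e and m·d.
  νᵘ-+-≥ : ∀ q r c → ℚᵘ.↥ q ≢ 0ℤ → ℚᵘ.↥ r ≢ 0ℤ → ℚᵘ.↥ (q ℚᵘ.+ r) ≢ 0ℤ →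
           c ≤ νᵘ q → c ≤ νᵘ r → c ≤ νᵘ (q ℚᵘ.+ r)
  νᵘ-+-≥ (mkℚᵘ n d) (mkℚᵘ m e) c n≢0 m≢0 sum≢0 c≤q c≤r =
    [ (λ a₁≤a₂ → bound a₁ c≤a₁ ℕP.≤-refl a₁≤a₂) , (λ a₂≤a₁ → bound a₂ c≤a₂ a₂≤a₁ ℕP.≤-refl) ]′ (ℕP.≤-total a₁ a₂)
    where
      a₁ = νℤ n ℕ.+ ν (suc e)
      a₂ = νℤ m ℕ.+ ν (suc d)
      D = ν (suc d) ℕ.+ ν (suc e)
      c≤a₁ : c ≤ + a₁ ℤ.- + D
      c≤a₁ = subst (c ≤_) (sym (+[a+c]-+[b+c]≡+a-+b (νℤ n) (ν (suc d)) (ν (suc e)))) c≤q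
      c≤a₂ : c ≤ + a₂ ℤ.- + D
      c≤a₂ = subst (c ≤_) (sym (+[a+b]-+[b+c]≡+a-+c (νℤ m) (ν (suc d)) (ν (suc e)))) c≤r
      bound : ∀ c′ → c ≤ + c′ ℤ.- + D → c′ ℕ.≤ a₁ → c′ ℕ.≤ a₂ →
              c ≤ + νℤ (n ℤ.* + suc e ℤ.+ m ℤ.* + suc d) ℤ.- + ν (suc d ℕ.* suc e)
      bound c′ c≤ c′≤a₁ c′≤a₂ = ≤-trans c≤ (subst (λ z → + c′ ℤ.- + D ≤ + νℤ (n ℤ.* + suc e ℤ.+ m ℤ.* + suc d) ℤ.- + z)
        (sym (ν-* (suc d) (suc e) (λ ()) (λ ())))
        (+-monoˡ-≤ (ℤ.- + D) (+≤+ (νℤ-+-≥ c′ (n ℤ.* + suc e) (m ℤ.* + suc d) sum≢0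
          (subst (c′ ℕ.≤_) (sym (νℤ-* n (+ suc e) n≢0 (λ ()))) c′≤a₁)
          (subst (c′ ℕ.≤_) (sym (νℤ-* m (+ suc d) m≢0 (λ ()))) c′≤a₂)))))

  νᵘ-+-< : ∀ q r → ℚᵘ.↥ q ≢ 0ℤ → ℚᵘ.↥ r ≢ 0ℤ → νᵘ q < νᵘ r →
           (ℚᵘ.↥ (q ℚᵘ.+ r) ≢ 0ℤ) × (νᵘ (q ℚᵘ.+ r) ≡ νᵘ q)
  νᵘ-+-< (mkℚᵘ n d) (mkℚᵘ m e) n≢0 m≢0 q<r = proj₁ dominant , val
    where
      a₁ = νℤ n ℕ.+ ν (suc e)
      a₂ = νℤ m ℕ.+ ν (suc d)
      D = ν (suc d) ℕ.+ ν (suc e)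
      ν-ne : νℤ (n ℤ.* + suc e) ≡ a₁
      ν-ne = νℤ-* n (+ suc e) n≢0 (λ ())
      a₁<a₂ : a₁ ℕ.< a₂
      a₁<a₂ = drop‿+<+ (subst₂ _<_ (cancel (+ a₁) (+ D)) (cancel (+ a₂) (+ D)) (+-monoˡ-< (+ D)
        (subst₂ _<_ (sym (+[a+c]-+[b+c]≡+a-+b (νℤ n) (ν (suc d)) (ν (suc e))))
                    (sym (+[a+b]-+[b+c]≡+a-+c (νℤ m) (ν (suc d)) (ν (suc e)))) q<r)))
        where
          cancel : ∀ a b → a ℤ.- b ℤ.+ b ≡ a
          cancel = ℤSolver.solve-∀
      ne≢0 : n ℤ.* + suc e ≢ 0ℤ
      ne≢0 ne≡0 with i*j≡0⇒i≡0∨j≡0 n ne≡0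
      ... | inj₁ n≡0 = n≢0 n≡0
      ... | inj₂ ()
      dominant = νℤ-+-< (n ℤ.* + suc e) (m ℤ.* + suc d) ne≢0
        (subst₂ ℕ._<_ (sym ν-ne) (sym (νℤ-* m (+ suc d) m≢0 (λ ()))) a₁<a₂)
      val : + νℤ (n ℤ.* + suc e ℤ.+ m ℤ.* + suc d) ℤ.- + ν (suc d ℕ.* suc e) ≡ + νℤ n ℤ.- + ν (suc d)
      val = trans (cong₂ (λ a b → + a ℤ.- + b) (trans (proj₂ dominant) ν-ne) (ν-* (suc d) (suc e) (λ ()) (λ ())))
                  (+[a+c]-+[b+c]≡+a-+b (νℤ n) (ν (suc d)) (ν (suc e)))

  νℚ-+-≥ : ∀ x y c → NZ x → NZ y → NZ (x ℚ.+ y) → c ≤ νℚ x → c ≤ νℚ y → c ≤ νℚ (x ℚ.+ y)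
  νℚ-+-≥ x y c x≢0 y≢0 x+y≢0 c≤x c≤y =
    subst (c ≤_) (sym (trans (νℚ-toℚᵘ (x ℚ.+ y)) (proj₂ homo)))
      (νᵘ-+-≥ (ℚ.toℚᵘ x) (ℚ.toℚᵘ y) c (↥ᵘ≢0 x x≢0) (↥ᵘ≢0 y y≢0) (proj₁ homo)
        (subst (c ≤_) (νℚ-toℚᵘ x) c≤x) (subst (c ≤_) (νℚ-toℚᵘ y) c≤y))
    where
      homo = νᵘ-cong (ℚ.toℚᵘ (x ℚ.+ y)) (ℚ.toℚᵘ x ℚᵘ.+ ℚ.toℚᵘ y) (ℚP.toℚᵘ-homo-+ x y) (↥ᵘ≢0 (x ℚ.+ y) x+y≢0)

  νℚ-+-< : ∀ x y → NZ x → NZ y → νℚ x < νℚ y → NZ (x ℚ.+ y) × (νℚ (x ℚ.+ y) ≡ νℚ x)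
  νℚ-+-< x y x≢0 y≢0 x<y =
    (λ eq → proj₁ homo (trans (↥-toℚᵘ (x ℚ.+ y)) eq)) ,
    trans (νℚ-toℚᵘ (x ℚ.+ y)) (trans (sym (proj₂ homo)) (trans (proj₂ dominant) (sym (νℚ-toℚᵘ x))))
    where
      dominant = νᵘ-+-< (ℚ.toℚᵘ x) (ℚ.toℚᵘ y) (↥ᵘ≢0 x x≢0) (↥ᵘ≢0 y y≢0) (subst₂ _<_ (νℚ-toℚᵘ x) (νℚ-toℚᵘ y) x<y)
      homo = νᵘ-cong (ℚ.toℚᵘ x ℚᵘ.+ ℚ.toℚᵘ y) (ℚ.toℚᵘ (x ℚ.+ y)) (ℚᵘP.≃-sym (ℚP.toℚᵘ-homo-+ x y)) (proj₁ dominant)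

  νℚ-fromℤ : ∀ z → z ≢ 0ℤ → NZ (z ℚ./ 1) × (νℚ (z ℚ./ 1) ≡ + νℤ z)
  νℚ-fromℤ z z≢0 with νᵘ-cong (mkℚᵘ z 0) (ℚ.toℚᵘ (z ℚ./ 1)) (ℚᵘP.≃-sym (ℚP.toℚᵘ-fromℚᵘ (mkℚᵘ z 0))) z≢0
  ... | ↥≢0 , νz≡ = (λ eq → ↥≢0 (trans (↥-toℚᵘ (z ℚ./ 1)) eq)) ,
    trans (νℚ-toℚᵘ (z ℚ./ 1)) (trans (sym νz≡) (trans (cong (λ x → + νℤ z ℤ.- + x) ν-1) (+-identityʳ (+ νℤ z))))

module Polynomial where

  open import Data.Nat as ℕ using (ℕ; zero; suc; _∸_; _≤_; _<_; s≤s)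
  import Data.Nat.Properties as ℕP
  open import Data.Integer as ℤ using (0ℤ)
  open import Data.Rational as ℚ using (ℚ; ↥_; 0ℚ)
  import Data.Rational.Properties as ℚP
  open import Data.List using ([]; _∷_; map; applyUpTo; replicate; _++_)
  open import Data.Product using (Σ; _×_; _,_)
  open import Data.Sum using (_⊎_; inj₁; inj₂)
  open import Relation.Nullary using (yes; no)
  open import Relation.Binary.PropositionalEquality
  open import Data.Nat.Tactic.RingSolver using (solve-∀)

  sumUpTo : (ℕ → ℚ) → ℕ → ℚ
  sumUpTo f zero    = f 0
  sumUpTo f (suc M) = f 0 ℚ.+ sumUpTo (λ i → f (suc i)) M

  conv : (ℕ → ℚ) → (ℕ → ℚ) → ℕ → ℚ
  conv g h N = sumUpTo (λ i → g i ℚ.* h (N ∸ i)) N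

  sumUpTo-zero : ∀ M f → (∀ i → f i ≡ 0ℚ) → sumUpTo f M ≡ 0ℚ
  sumUpTo-zero zero    f f≡0 = f≡0 0
  sumUpTo-zero (suc M) f f≡0 = cong₂ ℚ._+_ (f≡0 0) (sumUpTo-zero M (λ i → f (suc i)) (λ i → f≡0 (suc i)))

  conv-zeroʳ : ∀ g h N → (∀ i → ↥ (h i) ≡ 0ℤ) → conv g h N ≡ 0ℚ
  conv-zeroʳ g h N h≡0 = sumUpTo-zero N _
    (λ i → trans (cong (g i ℚ.*_) (ℚP.↥p≡0⇒p≡0 (h (N ∸ i)) (h≡0 (N ∸ i)))) (ℚP.*-zeroʳ (g i)))

  coeff-+ₚ : ∀ f g i → coeff (f +ₚ g) i ≡ coeff f i ℚ.+ coeff g i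
  coeff-+ₚ []      g       i       = sym (ℚP.+-identityˡ (coeff g i))
  coeff-+ₚ (a ∷ f) []      i       = sym (ℚP.+-identityʳ (coeff (a ∷ f) i))
  coeff-+ₚ (a ∷ f) (b ∷ g) zero    = refl
  coeff-+ₚ (a ∷ f) (b ∷ g) (suc i) = coeff-+ₚ f g i

  coeff-map-* : ∀ a g i → coeff (map (a ℚ.*_) g) i ≡ a ℚ.* coeff g i
  coeff-map-* a []      i       = sym (ℚP.*-zeroʳ a)
  coeff-map-* a (b ∷ g) zero    = refl
  coeff-map-* a (b ∷ g) (suc i) = coeff-map-* a g i

  coeff-*ₚ : ∀ g h N → coeff (g *ₚ h) N ≡ conv (coeff g) (coeff h) N
  coeff-*ₚ []      h N       = sym (sumUpTo-zero N _ (λ i → ℚP.*-zeroˡ (coeff h (N ∸ i))))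
  coeff-*ₚ (c ∷ g) h zero    = trans (coeff-+ₚ (map (c ℚ.*_) h) (0ℚ ∷ (g *ₚ h)) 0)
    (trans (cong (ℚ._+ 0ℚ) (coeff-map-* c h 0)) (ℚP.+-identityʳ _))
  coeff-*ₚ (c ∷ g) h (suc M) = trans (coeff-+ₚ (map (c ℚ.*_) h) (0ℚ ∷ (g *ₚ h)) (suc M))
    (cong₂ ℚ._+_ (coeff-map-* c h (suc M)) (coeff-*ₚ g h M))

  nonzero-coeff⊎zero : ∀ g → (Σ ℕ λ i → ↥ (coeff g i) ≢ 0ℤ) ⊎ (∀ i → ↥ (coeff g i) ≡ 0ℤ)
  nonzero-coeff⊎zero []      = inj₂ (λ _ → refl)
  nonzero-coeff⊎zero (c ∷ g) with ↥ c ℤ.≟ 0ℤ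
  ... | no c≢0 = inj₁ (0 , c≢0)
  ... | yes c≡0 with nonzero-coeff⊎zero g
  ... | inj₁ (i , gᵢ≢0) = inj₁ (suc i , gᵢ≢0)
  ... | inj₂ g≡0        = inj₂ λ { zero → c≡0 ; (suc i) → g≡0 i }

  coeff-map-applyUpTo : ∀ (f : ℕ → ℚ) (g : ℕ → ℕ) m N → N < m → coeff (map f (applyUpTo g m)) N ≡ f (g N)
  coeff-map-applyUpTo f g (suc m) zero    _         = refl
  coeff-map-applyUpTo f g (suc m) (suc N) (s≤s N<m) = coeff-map-applyUpTo f (λ x → g (suc x)) m N N<m

  coeff-map-applyUpTo-≥ : ∀ (f : ℕ → ℚ) (g : ℕ → ℕ) m N → m ≤ N → coeff (map f (applyUpTo g m)) N ≡ 0ℚ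
  coeff-map-applyUpTo-≥ f g zero    N       _         = refl
  coeff-map-applyUpTo-≥ f g (suc m) (suc N) (s≤s m≤N) = coeff-map-applyUpTo-≥ f (λ x → g (suc x)) m N m≤N

  private
    coeff-replicate-++ : ∀ r Y M → coeff (replicate r 0ℚ ++ Y) (r ℕ.+ M) ≡ coeff Y M
    coeff-replicate-++ zero    Y M = refl
    coeff-replicate-++ (suc r) Y M = coeff-replicate-++ r Y M

    coeff-replicate-++-≥ : ∀ r Y N → r ≤ N → coeff (replicate r 0ℚ ++ Y) N ≡ coeff Y (N ∸ r)
    coeff-replicate-++-≥ r Y N r≤N =
      trans (cong (coeff (replicate r 0ℚ ++ Y)) (sym (ℕP.m+[n∸m]≡n r≤N))) (coeff-replicate-++ r Y (N ∸ r))

    coeff-replicate-++-< : ∀ r Y N → N < r → coeff (replicate r 0ℚ ++ Y) N ≡ 0ℚ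
    coeff-replicate-++-< (suc r) Y zero    _         = refl
    coeff-replicate-++-< (suc r) Y (suc N) (s≤s N<r) = coeff-replicate-++-< r Y N N<r

    1+e*1+j : ∀ e j → suc e ℕ.* suc j ≡ suc (e ℕ.+ suc e ℕ.* j)
    1+e*1+j = solve-∀

  coeff-substXPow-* : ∀ e f j → coeff (substXPow (suc e) f) (suc e ℕ.* j) ≡ coeff f j
  coeff-substXPow-* e []      j       = refl
  coeff-substXPow-* e (c ∷ f) zero    = cong (coeff (substXPow (suc e) (c ∷ f))) (ℕP.*-zeroʳ e)
  coeff-substXPow-* e (c ∷ f) (suc j) = trans (cong (coeff (substXPow (suc e) (c ∷ f))) (1+e*1+j e j))
    (trans (coeff-replicate-++ e (substXPow (suc e) f) (suc e ℕ.* j)) (coeff-substXPow-* e f j))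

  coeff-substXPow : ∀ e f N → (coeff (substXPow (suc e) f) N ≡ 0ℚ)
    ⊎ (Σ ℕ λ j → (N ≡ suc e ℕ.* j) × (coeff (substXPow (suc e) f) N ≡ coeff f j))
  coeff-substXPow e []      N       = inj₁ refl
  coeff-substXPow e (c ∷ f) zero    = inj₂ (0 , sym (ℕP.*-zeroʳ e) , refl)
  coeff-substXPow e (c ∷ f) (suc N) with N ℕ.<? e
  ... | yes N<e = inj₁ (coeff-replicate-++-< e (substXPow (suc e) f) N N<e)
  ... | no N≮e with coeff-substXPow e f (N ∸ e)
  ... | inj₁ zero′ = inj₁ (trans (coeff-replicate-++-≥ e _ N (ℕP.≮⇒≥ N≮e)) zero′)
  ... | inj₂ (j , N∸e≡ , at-j) = inj₂ (suc j , N≡ , trans (coeff-replicate-++-≥ e _ N (ℕP.≮⇒≥ N≮e)) at-j)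
    where
      N≡ : suc N ≡ suc e ℕ.* suc j
      N≡ = trans (cong suc (trans (sym (ℕP.m+[n∸m]≡n (ℕP.≮⇒≥ N≮e))) (cong (e ℕ.+_) N∸e≡))) (sym (1+e*1+j e j))

  module _ (G : Poly) (c : ℕ → ℚ) (n : ℕ) (G≡c : ∀ N → N ≤ n → coeff G N ≡ c N)
           (G≡0 : ∀ N → n < N → coeff G N ≡ 0ℚ) where

    support : ∀ N → (↥ (coeff G N) ≡ 0ℤ) ⊎ (Σ ℕ λ j → (j ≤ n) × (N ≡ 1 ℕ.* j) × (coeff G N ≡ c j))
    support N with N ℕ.≤? n
    ... | yes N≤n = inj₂ (N , N≤n , sym (ℕP.*-identityˡ N) , G≡c N N≤n)
    ... | no N≰n  = inj₁ (cong ↥_ (G≡0 N (ℕP.≰⇒> N≰n)))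

    support-at : ∀ j → j ≤ n → coeff G (1 ℕ.* j) ≡ c j
    support-at j j≤n = trans (cong (coeff G) (ℕP.*-identityˡ j)) (G≡c j j≤n)

    substXPow-support : ∀ e N → (↥ (coeff (substXPow (suc e) G) N) ≡ 0ℤ)
      ⊎ (Σ ℕ λ j → (j ≤ n) × (N ≡ suc e ℕ.* j) × (coeff (substXPow (suc e) G) N ≡ c j))
    substXPow-support e N with coeff-substXPow e G N
    ... | inj₁ ≡0 = inj₁ (cong ↥_ ≡0)
    ... | inj₂ (j , N≡ej , ≡Gⱼ) with j ℕ.≤? n
    ... | yes j≤n = inj₂ (j , j≤n , N≡ej , trans ≡Gⱼ (G≡c j j≤n))
    ... | no j≰n  = inj₁ (cong ↥_ (trans ≡Gⱼ (G≡0 j (ℕP.≰⇒> j≰n))))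

    substXPow-support-at : ∀ e j → j ≤ n → coeff (substXPow (suc e) G) (suc e ℕ.* j) ≡ c j
    substXPow-support-at e j j≤n = trans (coeff-substXPow-* e G j) (G≡c j j≤n)

-- A coefficient x at index N is the point (N, νℚ x); the weight A·νℚ x + B·N measures it
-- against the family of parallel lines A·y + B·x = w.
module NewtonWeight (p : ℕ) (p-prime : Prime p) (A : ℕ) (B : ℤ) where

  open import Data.Nat as ℕ using (zero; suc; _∸_; z≤n; s≤s)
  import Data.Nat.Properties as ℕP
  open import Data.Integer as ℤ using (+_; _≤_; _<_; 0ℤ)
  open import Data.Integer.Properties
  open import Data.Rational as ℚ using (ℚ; ↥_)
  import Data.Rational.Properties as ℚP
  open import Data.List using ([]; _∷_)
  open import Data.Product using (Σ; _×_; _,_; proj₁; proj₂)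
  open import Data.Sum using (_⊎_; inj₁; inj₂)
  open import Data.Empty using (⊥-elim)
  open import Relation.Nullary using (yes; no)
  open import Relation.Binary.Definitions using (tri<; tri≈; tri>)
  open import Relation.Binary.PropositionalEquality
  import Data.Integer.Tactic.RingSolver as ℤSolver
  open Polynomial
  open RatValuation p p-prime public

  weight : ℕ → ℚ → ℤ
  weight N x = + A ℤ.* νℚ x ℤ.+ B ℤ.* + N

  Weight≥ : ℕ → ℚ → ℤ → Set
  Weight≥ N x w = (↥ x ≡ 0ℤ) ⊎ (NZ x × (w ≤ weight N x))

  Weight> : ℕ → ℚ → ℤ → Set
  Weight> N x w = Weight≥ N x (ℤ.suc w)

  Weight≡ : ℕ → ℚ → ℤ → Set
  Weight≡ N x w = NZ x × (weight N x ≡ w)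

  MinWeightAt : (ℕ → ℚ) → ℤ → ℕ → Set
  MinWeightAt F w a = (∀ i → Weight≥ i (F i) w) × (∀ i → i ℕ.< a → Weight> i (F i) w) × Weight≡ a (F a) w

  minimum-nonzero : ∀ {F w a} → MinWeightAt F w a → NZ (F a)
  minimum-nonzero (_ , _ , Fₐ≢0 , _) = Fₐ≢0

  minimum-weight : ∀ {F w a} → MinWeightAt F w a → weight a (F a) ≡ w
  minimum-weight (_ , _ , _ , Wₐ≡w) = Wₐ≡w

  weight≥-mono : ∀ {N x w w′} → w′ ≤ w → Weight≥ N x w → Weight≥ N x w′
  weight≥-mono w′≤w (inj₁ x≡0)       = inj₁ x≡0
  weight≥-mono w′≤w (inj₂ (x≢0 , w≤)) = inj₂ (x≢0 , ≤-trans w′≤w w≤)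

  weight-* : ∀ i j x y → NZ x → NZ y → weight (i ℕ.+ j) (x ℚ.* y) ≡ weight i x ℤ.+ weight j y
  weight-* i j x y x≢0 y≢0 =
    trans (cong₂ (λ a b → + A ℤ.* a ℤ.+ B ℤ.* b) (proj₂ (νℚ-* x y x≢0 y≢0)) (pos-+ i j))
          (distrib (+ A) B (νℚ x) (νℚ y) (+ i) (+ j))
    where
      distrib : ∀ A B u v i j → A ℤ.* (u ℤ.+ v) ℤ.+ B ℤ.* (i ℤ.+ j) ≡ A ℤ.* u ℤ.+ B ℤ.* i ℤ.+ (A ℤ.* v ℤ.+ B ℤ.* j)
      distrib = ℤSolver.solve-∀

  weight≥-* : ∀ {i j x y w₁ w₂} → Weight≥ i x w₁ → Weight≥ j y w₂ → Weight≥ (i ℕ.+ j) (x ℚ.* y) (w₁ ℤ.+ w₂)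
  weight≥-* {x = x} {y} (inj₁ x≡0) _ =
    inj₁ (cong ↥_ (trans (cong (ℚ._* y) (ℚP.↥p≡0⇒p≡0 x x≡0)) (ℚP.*-zeroˡ y)))
  weight≥-* {x = x} {y} (inj₂ _) (inj₁ y≡0) =
    inj₁ (cong ↥_ (trans (cong (x ℚ.*_) (ℚP.↥p≡0⇒p≡0 y y≡0)) (ℚP.*-zeroʳ x)))
  weight≥-* {i} {j} {x} {y} (inj₂ (x≢0 , w₁≤)) (inj₂ (y≢0 , w₂≤)) =
    inj₂ (proj₁ (νℚ-* x y x≢0 y≢0) , subst (_ ≤_) (sym (weight-* i j x y x≢0 y≢0)) (+-mono-≤ w₁≤ w₂≤))

  weight≡-* : ∀ {i j x y w₁ w₂} → Weight≡ i x w₁ → Weight≡ j y w₂ → Weight≡ (i ℕ.+ j) (x ℚ.* y) (w₁ ℤ.+ w₂)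
  weight≡-* {i} {j} {x} {y} (x≢0 , eq₁) (y≢0 , eq₂) =
    proj₁ (νℚ-* x y x≢0 y≢0) , trans (weight-* i j x y x≢0 y≢0) (cong₂ ℤ._+_ eq₁ eq₂)

  private
    A*-mono-≤ : ∀ {u v} → u ≤ v → + A ℤ.* u ≤ + A ℤ.* v
    A*-mono-≤ = *-monoˡ-≤-nonNeg (+ A)

  weight≥-+ : ∀ {N x y w} → Weight≥ N x w → Weight≥ N y w → Weight≥ N (x ℚ.+ y) w
  weight≥-+ {N} {x} {y} (inj₁ x≡0) y≥ =
    subst (λ t → Weight≥ N t _) (sym (trans (cong (ℚ._+ y) (ℚP.↥p≡0⇒p≡0 x x≡0)) (ℚP.+-identityˡ y))) y≥
  weight≥-+ {N} {x} {y} x≥@(inj₂ _) (inj₁ y≡0) =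
    subst (λ t → Weight≥ N t _) (sym (trans (cong (x ℚ.+_) (ℚP.↥p≡0⇒p≡0 y y≡0)) (ℚP.+-identityʳ x))) x≥
  weight≥-+ {N} {x} {y} (inj₂ (x≢0 , w≤x)) (inj₂ (y≢0 , w≤y)) with ↥ (x ℚ.+ y) ℤ.≟ 0ℤ
  ... | yes x+y≡0 = inj₁ x+y≡0
  ... | no x+y≢0 with ≤-total (νℚ x) (νℚ y)
  ... | inj₁ x≤y = inj₂ (x+y≢0 , ≤-trans w≤x (+-monoˡ-≤ (B ℤ.* + N) (A*-mono-≤ (νℚ-+-≥ x y (νℚ x) x≢0 y≢0 x+y≢0 ≤-refl x≤y))))
  ... | inj₂ y≤x = inj₂ (x+y≢0 , ≤-trans w≤y (+-monoˡ-≤ (B ℤ.* + N) (A*-mono-≤ (νℚ-+-≥ x y (νℚ y) x≢0 y≢0 x+y≢0 y≤x ≤-refl))))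

  weight≡-+ : ∀ {N x y w} → Weight≡ N x w → Weight> N y w → Weight≡ N (x ℚ.+ y) w
  weight≡-+ {N} {x} {y} {w} x≡ (inj₁ y≡0) =
    subst (λ t → Weight≡ N t w) (sym (trans (cong (x ℚ.+_) (ℚP.↥p≡0⇒p≡0 y y≡0)) (ℚP.+-identityʳ x))) x≡
  weight≡-+ {N} {x} {y} {w} (x≢0 , wx≡) (inj₂ (y≢0 , w<y)) =
    proj₁ dominant , trans (cong (λ t → + A ℤ.* t ℤ.+ B ℤ.* + N) (proj₂ dominant)) wx≡
    where
      x<y : νℚ x < νℚ y
      x<y with νℚ x <? νℚ y
      ... | yes x<y = x<y
      ... | no x≮y = ⊥-elim (<-irrefl refl (≤-<-trans (+-monoˡ-≤ (B ℤ.* + N) (A*-mono-≤ (≮⇒≥ x≮y)))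
                       (suc[i]≤j⇒i<j (subst (λ t → ℤ.suc t ≤ weight N y) (sym wx≡) w<y))))
      dominant = νℚ-+-< x y x≢0 y≢0 x<y

  weight≡-+ˡ : ∀ {N x y w} → Weight> N x w → Weight≡ N y w → Weight≡ N (x ℚ.+ y) w
  weight≡-+ˡ {N} {x} {y} {w} x> y≡ = subst (λ t → Weight≡ N t w) (ℚP.+-comm y x) (weight≡-+ {N} {y} {x} y≡ x>)

  weight≥-sumUpTo : ∀ M f N w → (∀ i → i ℕ.≤ M → Weight≥ N (f i) w) → Weight≥ N (sumUpTo f M) w
  weight≥-sumUpTo zero    f N w f≥ = f≥ 0 z≤n
  weight≥-sumUpTo (suc M) f N w f≥ = weight≥-+ {N} {f 0} (f≥ 0 z≤n)
    (weight≥-sumUpTo M (λ i → f (suc i)) N w (λ i i≤M → f≥ (suc i) (s≤s i≤M)))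

  weight≡-sumUpTo : ∀ M f N w i₀ → i₀ ℕ.≤ M → Weight≡ N (f i₀) w →
                    (∀ i → i ℕ.≤ M → i ≢ i₀ → Weight> N (f i) w) → Weight≡ N (sumUpTo f M) w
  weight≡-sumUpTo zero    f N w zero     _           f≡ f> = f≡
  weight≡-sumUpTo (suc M) f N w zero     _           f≡ f> = weight≡-+ {N} {f 0} f≡
    (weight≥-sumUpTo M (λ i → f (suc i)) N (ℤ.suc w) (λ i i≤M → f> (suc i) (s≤s i≤M) (λ ())))
  weight≡-sumUpTo (suc M) f N w (suc i₀) (s≤s i₀≤M) f≡ f> = weight≡-+ˡ {N} {f 0} (f> 0 z≤n (λ ()))
    (weight≡-sumUpTo M (λ i → f (suc i)) N w i₀ i₀≤M f≡ (λ i i≤M i≢ → f> (suc i) (s≤s i≤M) (λ eq → i≢ (ℕP.suc-injective eq))))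

  private
    ∸-<-left : ∀ {N i a b} → i ℕ.≤ N → a ℕ.≤ i → N ℕ.< a ℕ.+ b → N ∸ i ℕ.< b
    ∸-<-left {N} {i} {a} {b} i≤N a≤i N< = ℕP.+-cancelˡ-< a (N ∸ i) b
      (ℕP.≤-<-trans (ℕP.≤-trans (ℕP.+-monoˡ-≤ (N ∸ i) a≤i) (ℕP.≤-reflexive (ℕP.m+[n∸m]≡n i≤N))) N<)

    ∸-<-right : ∀ {N i a b} → i ℕ.≤ N → a ℕ.< i → N ℕ.≤ a ℕ.+ b → N ∸ i ℕ.< b
    ∸-<-right {N} {i} {a} {b} i≤N a<i N≤ = ℕP.+-cancelˡ-< a (N ∸ i) b
      (ℕP.<-≤-trans (ℕP.<-≤-trans (ℕP.+-monoˡ-< (N ∸ i) a<i) (ℕP.≤-reflexive (ℕP.m+[n∸m]≡n i≤N))) N≤)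

  -- Every term g i · h (N − i) of the convolution has weight ≥ wg + wh; at N = a + b
  -- the only term of exactly that weight is g a · h b.
  minWeightAt-conv : ∀ g h wg wh a b → MinWeightAt g wg a → MinWeightAt h wh b →
                     MinWeightAt (conv g h) (wg ℤ.+ wh) (a ℕ.+ b)
  minWeightAt-conv g h wg wh a b (g≥ , g> , g≡) (h≥ , h> , h≡) = conv≥ , conv> , conv≡
    where
      term : ∀ N i → ℕ → ℤ → Set
      term N i M w = Weight≥ M (g i ℚ.* h (N ∸ i)) w
      term≥ : ∀ N i → i ℕ.≤ N → Weight≥ N (g i ℚ.* h (N ∸ i)) (wg ℤ.+ wh)
      term≥ N i i≤N = subst (λ M → term N i M (wg ℤ.+ wh)) (ℕP.m+[n∸m]≡n i≤N)
        (weight≥-* {i} {N ∸ i} {g i} {h (N ∸ i)} (g≥ i) (h≥ (N ∸ i)))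
      term>ˡ : ∀ N i → i ℕ.≤ N → i ℕ.< a → Weight> N (g i ℚ.* h (N ∸ i)) (wg ℤ.+ wh)
      term>ˡ N i i≤N i<a = subst₂ (term N i) (ℕP.m+[n∸m]≡n i≤N) (+-assoc (+ 1) wg wh)
        (weight≥-* {i} {N ∸ i} {g i} {h (N ∸ i)} (g> i i<a) (h≥ (N ∸ i)))
      term>ʳ : ∀ N i → i ℕ.≤ N → N ∸ i ℕ.< b → Weight> N (g i ℚ.* h (N ∸ i)) (wg ℤ.+ wh)
      term>ʳ N i i≤N <b = subst₂ (term N i) (ℕP.m+[n∸m]≡n i≤N) (+-shuffle wg wh)
        (weight≥-* {i} {N ∸ i} {g i} {h (N ∸ i)} (g≥ i) (h> (N ∸ i) <b))
        where
          +-shuffle : ∀ u v → u ℤ.+ (+ 1 ℤ.+ v) ≡ + 1 ℤ.+ (u ℤ.+ v)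
          +-shuffle = ℤSolver.solve-∀
      conv≥ : ∀ N → Weight≥ N (conv g h N) (wg ℤ.+ wh)
      conv≥ N = weight≥-sumUpTo N _ N _ (term≥ N)
      conv> : ∀ N → N ℕ.< a ℕ.+ b → Weight> N (conv g h N) (wg ℤ.+ wh)
      conv> N N<a+b = weight≥-sumUpTo N _ N _ term>
        where
          term> : ∀ i → i ℕ.≤ N → Weight> N (g i ℚ.* h (N ∸ i)) (wg ℤ.+ wh)
          term> i i≤N with i ℕ.<? a
          ... | yes i<a = term>ˡ N i i≤N i<a
          ... | no i≮a  = term>ʳ N i i≤N (∸-<-left i≤N (ℕP.≮⇒≥ i≮a) N<a+b)
      conv≡ : Weight≡ (a ℕ.+ b) (conv g h (a ℕ.+ b)) (wg ℤ.+ wh)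
      conv≡ = weight≡-sumUpTo (a ℕ.+ b) _ (a ℕ.+ b) _ a (ℕP.m≤m+n a b) at-a term>
        where
          at-a : Weight≡ (a ℕ.+ b) (g a ℚ.* h (a ℕ.+ b ∸ a)) (wg ℤ.+ wh)
          at-a = subst (λ t → Weight≡ (a ℕ.+ b) (g a ℚ.* h t) (wg ℤ.+ wh)) (sym (ℕP.m+n∸m≡n a b))
            (weight≡-* {a} {b} {g a} {h b} g≡ h≡)
          term> : ∀ i → i ℕ.≤ a ℕ.+ b → i ≢ a → Weight> (a ℕ.+ b) (g i ℚ.* h (a ℕ.+ b ∸ i)) (wg ℤ.+ wh)
          term> i i≤ i≢a with ℕP.<-cmp i a
          ... | tri< i<a _ _ = term>ˡ (a ℕ.+ b) i i≤ i<a
          ... | tri≈ _ i≡a _ = ⊥-elim (i≢a i≡a)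
          ... | tri> _ _ a<i = term>ʳ (a ℕ.+ b) i i≤ (∸-<-right i≤ a<i ℕP.≤-refl)

  private
    weight-suc : ∀ i x → weight (suc i) x ≡ weight i x ℤ.+ B
    weight-suc i x = distrib (+ A ℤ.* νℚ x) B (+ i)
      where
        distrib : ∀ u b j → u ℤ.+ b ℤ.* (+ 1 ℤ.+ j) ≡ u ℤ.+ b ℤ.* j ℤ.+ b
        distrib = ℤSolver.solve-∀

    weight≥-suc : ∀ {i x w} → Weight≥ i x w → Weight≥ (suc i) x (w ℤ.+ B)
    weight≥-suc         (inj₁ x≡0)       = inj₁ x≡0
    weight≥-suc {i} {x} (inj₂ (x≢0 , w≤)) = inj₂ (x≢0 , subst (_ ≤_) (sym (weight-suc i x)) (+-monoˡ-≤ B w≤))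

    weight>-suc : ∀ {i x w} → Weight> i x w → Weight> (suc i) x (w ℤ.+ B)
    weight>-suc {i} {x} {w} x> = subst (Weight≥ (suc i) x) (+-assoc (+ 1) w B) (weight≥-suc {i} {x} x>)

    weight≡-suc : ∀ {i x w} → Weight≡ i x w → Weight≡ (suc i) x (w ℤ.+ B)
    weight≡-suc {i} {x} (x≢0 , eq) = x≢0 , trans (weight-suc i x) (cong (ℤ._+ B) eq)

    shift≥ : ∀ {c g w} → Weight≥ 0 c (w ℤ.+ B) → (∀ j → Weight≥ j (coeff g j) w) →
             ∀ j → Weight≥ j (coeff (c ∷ g) j) (w ℤ.+ B)
    shift≥         c≥ g≥ zero    = c≥
    shift≥ {g = g} c≥ g≥ (suc j) = weight≥-suc {j} {coeff g j} (g≥ j)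

    shift> : ∀ {c g w a} → Weight> 0 c (w ℤ.+ B) → (∀ j → j ℕ.< a → Weight> j (coeff g j) w) →
             ∀ j → j ℕ.< suc a → Weight> j (coeff (c ∷ g) j) (w ℤ.+ B)
    shift>             c> g> zero    _         = c>
    shift> {g = g} {w} c> g> (suc j) (s≤s j<a) = weight>-suc {j} {coeff g j} {w} (g> j j<a)

  -- Shifting the coefficients by one index adds B to every weight; the constant term then
  -- either sets a new minimum (at index 0) or not.
  minWeightAt-exists : ∀ g → Σ ℕ (λ i → NZ (coeff g i)) → Σ ℤ λ w → Σ ℕ λ a → MinWeightAt (coeff g) w a
  minWeightAt-exists []      (i , gᵢ≢0) = ⊥-elim (gᵢ≢0 refl)
  minWeightAt-exists (c ∷ g) (i , gᵢ≢0) with nonzero-coeff⊎zero g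
  ... | inj₂ g≡0 = weight 0 c , 0 , at0≥ , (λ _ ()) , (c≢0 i gᵢ≢0 , refl)
    where
      c≢0 : ∀ k → NZ (coeff (c ∷ g) k) → NZ c
      c≢0 zero    c≢0 = c≢0
      c≢0 (suc j) gⱼ≢0 = ⊥-elim (gⱼ≢0 (g≡0 j))
      at0≥ : ∀ j → Weight≥ j (coeff (c ∷ g) j) (weight 0 c)
      at0≥ zero    = inj₂ (c≢0 i gᵢ≢0 , ≤-refl)
      at0≥ (suc j) = inj₁ (g≡0 j)
  ... | inj₁ nonzero with minWeightAt-exists g nonzero
  ... | w , a , g≥ , g> , g≡ with ↥ c ℤ.≟ 0ℤ | weight 0 c ≤? w ℤ.+ B
  ... | yes c≡0 | _ =
    w ℤ.+ B , suc a , shift≥ {c} (inj₁ c≡0) g≥ , shift> {c} {g} {w} (inj₁ c≡0) g> , weight≡-suc {a} {coeff g a} g≡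
  ... | no c≢0 | yes c≤ = weight 0 c , 0 , at0≥ , (λ _ ()) , (c≢0 , refl)
    where
      at0≥ : ∀ j → Weight≥ j (coeff (c ∷ g) j) (weight 0 c)
      at0≥ zero    = inj₂ (c≢0 , ≤-refl)
      at0≥ (suc j) = weight≥-mono {suc j} {coeff g j} c≤ (weight≥-suc {j} {coeff g j} (g≥ j))
  ... | no c≢0 | no c≰ =
    w ℤ.+ B , suc a , shift≥ {c} (inj₂ (c≢0 , <⇒≤ (≰⇒> c≰))) g≥ , shift> {c} {g} {w} (inj₂ (c≢0 , i<j⇒suc[i]≤j (≰⇒> c≰))) g> ,
    weight≡-suc {a} {coeff g a} g≡

-- slope: every segment from (0, ν c₀) to a point (j, ν cⱼ) has slope greater than −1/k
module NewtonCriterion (p : ℕ) (p-prime : Prime p) (e k n i₀ : ℕ) (c : ℕ → ℚ) (F : Poly)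
  (1≤e : 1 ℕ.≤ e) (1≤k : 1 ℕ.≤ k) (n<i₀+k : n ℕ.< i₀ ℕ.+ k)
  (F-support : ∀ N → (ℚ.↥ coeff F N ≡ ℤ.0ℤ) ⊎ (Σ ℕ λ j → (j ℕ.≤ n) × (N ≡ e ℕ.* j) × (coeff F N ≡ c j)))
  (F-at : ∀ j → j ℕ.≤ n → coeff F (e ℕ.* j) ≡ c j)
  (cₙ≢0 : RatValuation.NZ p p-prime (c n)) (ν-cₙ : RatValuation.νℚ p p-prime (c n) ≡ ℤ.0ℤ)
  (ν-below-i₀ : ∀ j → j ℕ.< i₀ → RatValuation.NZ p p-prime (c j) → + 1 ℤ.≤ RatValuation.νℚ p p-prime (c j))
  (c₀≢0 : RatValuation.NZ p p-prime (c 0))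
  (slope : ∀ j → 1 ℕ.≤ j → j ℕ.≤ n → RatValuation.NZ p p-prime (c j) →
           + k ℤ.* (RatValuation.νℚ p p-prime (c 0) ℤ.- RatValuation.νℚ p p-prime (c j)) ℤ.< + j)
  where

  open import Data.Nat using (zero; suc; z≤n; s≤s; _∸_)
  import Data.Nat.Properties as ℕP
  open import Data.Integer using (+_; -[1+_]; 0ℤ; _≤_; _<_; +≤+)
  open import Data.Integer.Properties
  open import Data.Rational using (↥_)
  import Data.Rational.Properties as ℚP
  open import Data.Product using (_,_; proj₁; proj₂)
  open import Data.Sum using (inj₁; inj₂)
  open import Data.Empty using (⊥; ⊥-elim)
  open import Relation.Nullary using (¬_; yes; no)
  open import Relation.Binary.PropositionalEquality
  import Data.Integer.Tactic.RingSolver as ℤSolver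
  open import Data.Nat.Tactic.RingSolver using (solve-∀)
  open Polynomial
  open RatValuation p p-prime

  private
    +-cancelˡ-≤ : ∀ a b c → a ℤ.+ b ≤ a ℤ.+ c → b ≤ c
    +-cancelˡ-≤ a b c le = subst₂ _≤_ (cancel a b) (cancel a c) (+-monoʳ-≤ (ℤ.- a) le)
      where
        cancel : ∀ a b → ℤ.- a ℤ.+ (a ℤ.+ b) ≡ b
        cancel = ℤSolver.solve-∀

    ≤⇒∃+ : ∀ {a b : ℤ} → a ≤ b → Σ ℕ λ δ → b ≡ a ℤ.+ + δ
    ≤⇒∃+ {a} {b} a≤b with b ℤ.- a in eq | i≤j⇒0≤j-i a≤b
    ... | + δ | _ = δ , trans (a+[b-a] a b) (cong (λ x → a ℤ.+ x) eq)
      where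
        a+[b-a] : ∀ a b → b ≡ a ℤ.+ (b ℤ.- a)
        a+[b-a] = ℤSolver.solve-∀

    -- the slope of the edge from (0, ν c₀) to (j, ν c j) is δ / j < 1 / k
    steep-slope : ∀ j δ → k ℕ.* δ ℕ.< j → j ℕ.≤ n → (n ℕ.* (e ℕ.* k) ℕ.+ 1) ℕ.* δ ℕ.≤ n ℕ.* (e ℕ.* j)
    steep-slope j δ kδ<j j≤n = begin
      (n ℕ.* (e ℕ.* k) ℕ.+ 1) ℕ.* δ       ≡⟨ expand n e k δ ⟩
      n ℕ.* e ℕ.* (k ℕ.* δ) ℕ.+ δ         ≤⟨ ℕP.+-monoʳ-≤ (n ℕ.* e ℕ.* (k ℕ.* δ)) δ≤ne ⟩
      n ℕ.* e ℕ.* (k ℕ.* δ) ℕ.+ n ℕ.* e   ≡⟨ collect n e (k ℕ.* δ) ⟩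
      n ℕ.* e ℕ.* suc (k ℕ.* δ)           ≤⟨ ℕP.*-monoʳ-≤ (n ℕ.* e) kδ<j ⟩
      n ℕ.* e ℕ.* j                       ≡⟨ ℕP.*-assoc n e j ⟩
      n ℕ.* (e ℕ.* j)                     ∎
      where
        open ℕP.≤-Reasoning
        expand : ∀ n e k δ → (n ℕ.* (e ℕ.* k) ℕ.+ 1) ℕ.* δ ≡ n ℕ.* e ℕ.* (k ℕ.* δ) ℕ.+ δ
        expand = solve-∀
        collect : ∀ n e x → n ℕ.* e ℕ.* x ℕ.+ n ℕ.* e ≡ n ℕ.* e ℕ.* suc x
        collect = solve-∀
        δ≤ne : δ ℕ.≤ n ℕ.* e
        δ≤ne = ℕP.≤-trans (ℕP.<⇒≤ (ℕP.≤-<-trans (ℕP.m≤n*m δ k {{ℕ.>-nonZero 1≤k}}) kδ<j))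
                 (ℕP.≤-trans j≤n (ℕP.m≤m*n n e {{ℕ.>-nonZero 1≤e}}))

    index-positive : ∀ m a b j → e ℕ.* k ∸ e ℕ.+ 1 ℕ.≤ m →
                     a ℕ.+ b ≡ e ℕ.* j → i₀ ℕ.≤ j → b ℕ.+ m ℕ.≤ e ℕ.* n → 1 ℕ.≤ a
    index-positive m a b j m-lo a+b≡ i₀≤j b+m≤ =
      ℕP.+-cancelʳ-< (e ℕ.* n ℕ.+ e) 0 a (ℕP.≤-<-trans (ℕP.≤-reflexive (shift e n)) chain)
      where
        open ℕP.≤-Reasoning
        ek<m+e : e ℕ.* k ℕ.< m ℕ.+ e
        ek<m+e = begin-strict
          e ℕ.* k            ≡⟨ ℕP.m∸n+n≡m (ℕP.m≤m*n e k {{ℕ.>-nonZero 1≤k}}) ⟨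
          e ℕ.* k ∸ e ℕ.+ e  <⟨ ℕP.+-monoˡ-< e (ℕP.<-≤-trans (ℕP.≤-reflexive (ℕP.+-comm 1 (e ℕ.* k ∸ e))) m-lo) ⟩
          m ℕ.+ e            ∎
        shift : ∀ e n → 0 ℕ.+ (e ℕ.* n ℕ.+ e) ≡ e ℕ.* suc n
        shift = solve-∀
        regroup : ∀ a b m e → a ℕ.+ b ℕ.+ (m ℕ.+ e) ≡ a ℕ.+ (b ℕ.+ m ℕ.+ e)
        regroup = solve-∀
        chain : e ℕ.* suc n ℕ.< a ℕ.+ (e ℕ.* n ℕ.+ e)
        chain = begin-strict
          e ℕ.* suc n            ≤⟨ ℕP.*-monoʳ-≤ e n<i₀+k ⟩
          e ℕ.* (i₀ ℕ.+ k)       ≡⟨ ℕP.*-distribˡ-+ e i₀ k ⟩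
          e ℕ.* i₀ ℕ.+ e ℕ.* k   ≤⟨ ℕP.+-monoˡ-≤ (e ℕ.* k) (ℕP.*-monoʳ-≤ e i₀≤j) ⟩
          e ℕ.* j ℕ.+ e ℕ.* k    ≡⟨ cong (ℕ._+ e ℕ.* k) a+b≡ ⟨
          a ℕ.+ b ℕ.+ e ℕ.* k    <⟨ ℕP.+-monoʳ-< (a ℕ.+ b) ek<m+e ⟩
          a ℕ.+ b ℕ.+ (m ℕ.+ e)  ≡⟨ regroup a b m e ⟩
          a ℕ.+ (b ℕ.+ m ℕ.+ e)  ≤⟨ ℕP.+-monoʳ-≤ a (ℕP.+-monoˡ-≤ e b+m≤) ⟩
          a ℕ.+ (e ℕ.* n ℕ.+ e)  ∎

  private
    module Degree    = NewtonWeight p p-prime 0 -[1+ 0 ]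
    module Valuation = NewtonWeight p p-prime 1 (+ 0)

    Aₙ : ℕ
    Aₙ = n ℕ.* (e ℕ.* k) ℕ.+ 1

    -- Aₙ > n·e·k ≥ n·m: on indices in [0, m], one unit of valuation outweighs any change of index
    module Steep     = NewtonWeight p p-prime Aₙ (+ n)

    degree-weight : ∀ N x → Degree.weight N x ≡ ℤ.- (+ N)
    degree-weight N x = simplify (νℚ x) (+ N)
      where
        simplify : ∀ v n → + 0 ℤ.* v ℤ.+ -[1+ 0 ] ℤ.* n ≡ ℤ.- n
        simplify = ℤSolver.solve-∀

    valuation-weight : ∀ N x → Valuation.weight N x ≡ νℚ x
    valuation-weight N x = simplify (νℚ x) (+ N)
      where
        simplify : ∀ v n → + 1 ℤ.* v ℤ.+ + 0 ℤ.* n ≡ v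
        simplify = ℤSolver.solve-∀

    0≤n*N : ∀ N → + 0 ≤ + n ℤ.* + N
    0≤n*N N = subst (+ 0 ≤_) (pos-* n N) (+≤+ z≤n)

  F-index : ∀ N → NZ (coeff F N) → Σ ℕ λ j → (j ℕ.≤ n) × (N ≡ e ℕ.* j) × (coeff F N ≡ c j)
  F-index N F≢0 with F-support N
  ... | inj₁ F≡0 = ⊥-elim (F≢0 F≡0)
  ... | inj₂ at-j = at-j

  F-top : coeff F (e ℕ.* n) ≡ c n
  F-top = F-at n ℕP.≤-refl

  F-bottom : coeff F 0 ≡ c 0
  F-bottom = trans (cong (coeff F) (sym (ℕP.*-zeroʳ e))) (F-at 0 z≤n)

  constant-term-minimal : ∀ N → NZ (coeff F N) → Steep.weight 0 (c 0) ≤ Steep.weight N (coeff F N)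
  constant-term-minimal N F≢0 with F-index N F≢0
  ... | zero , _ , _ , F≡c₀ =
    subst (λ t → Steep.weight 0 (c 0) ≤ Steep.weight N t) (sym F≡c₀)
          (+-monoʳ-≤ (+ Aₙ ℤ.* νℚ (c 0)) (subst (_≤ + n ℤ.* + N) (sym (*-zeroʳ (+ n))) (0≤n*N N)))
  ... | suc j′ , j≤n , N≡ej , F≡cⱼ = subst (λ t → Steep.weight 0 (c 0) ≤ Steep.weight N t) (sym F≡cⱼ) vertex
    where
      j = suc j′
      ν₀ = νℚ (c 0)
      νⱼ = νℚ (c j)
      vertex : Steep.weight 0 (c 0) ≤ Steep.weight N (c j)
      vertex with ν₀ ≤? νⱼ
      ... | yes ν₀≤νⱼ = +-mono-≤ (*-monoˡ-≤-nonNeg (+ Aₙ) ν₀≤νⱼ) (subst (_≤ + n ℤ.* + N) (sym (*-zeroʳ (+ n))) (0≤n*N N))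
      ... | no ν₀≰νⱼ with ≤⇒∃+ (<⇒≤ (≰⇒> ν₀≰νⱼ))
      ... | δ , ν₀≡ = begin
        + Aₙ ℤ.* ν₀ ℤ.+ + n ℤ.* + 0           ≡⟨ cong (λ t → + Aₙ ℤ.* t ℤ.+ + n ℤ.* + 0) ν₀≡ ⟩
        + Aₙ ℤ.* (νⱼ ℤ.+ + δ) ℤ.+ + n ℤ.* + 0 ≡⟨ distrib (+ Aₙ) νⱼ (+ δ) (+ n) ⟩
        + Aₙ ℤ.* νⱼ ℤ.+ + Aₙ ℤ.* + δ          ≡⟨ cong (λ t → + Aₙ ℤ.* νⱼ ℤ.+ t) (pos-* Aₙ δ) ⟨
        + Aₙ ℤ.* νⱼ ℤ.+ + (Aₙ ℕ.* δ)          ≤⟨ +-monoʳ-≤ (+ Aₙ ℤ.* νⱼ) (+≤+ (steep-slope j δ kδ<j j≤n)) ⟩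
        + Aₙ ℤ.* νⱼ ℤ.+ + (n ℕ.* (e ℕ.* j))   ≡⟨ cong (λ t → + Aₙ ℤ.* νⱼ ℤ.+ t) (trans (pos-* n (e ℕ.* j)) (cong (λ t → + n ℤ.* + t) (sym N≡ej))) ⟩
        + Aₙ ℤ.* νⱼ ℤ.+ + n ℤ.* + N           ∎
        where
          open ≤-Reasoning
          distrib : ∀ A v d n → A ℤ.* (v ℤ.+ d) ℤ.+ n ℤ.* + 0 ≡ A ℤ.* v ℤ.+ A ℤ.* d
          distrib = ℤSolver.solve-∀
          diff : ∀ a b d → a ≡ b ℤ.+ d → a ℤ.- b ≡ d
          diff a b d a≡ = trans (cong (ℤ._- b) a≡) (cancel b d)
            where
              cancel : ∀ b d → b ℤ.+ d ℤ.- b ≡ d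
              cancel = ℤSolver.solve-∀
          kδ<j : k ℕ.* δ ℕ.< j
          kδ<j = drop‿+<+ (subst (_< + j) (trans (cong (λ t → + k ℤ.* t) (diff ν₀ νⱼ (+ δ) ν₀≡)) (sym (pos-* k δ)))
                                        (slope j (s≤s z≤n) j≤n (λ cⱼ≡0 → F≢0 (trans (cong ↥_ F≡cⱼ) cⱼ≡0))))

  -- Aₙ·(1 + ν Gₐ) ≤ Aₙ·ν G₀ ≤ Aₙ·ν Gₐ + n·a would force Aₙ ≤ n·a ≤ n·e·k < Aₙ.
  no-drop-at-steep-minimum : ∀ (G : ℕ → ℚ) a wg → a ℕ.≤ e ℕ.* k → NZ (G a) →
                             Steep.MinWeightAt G wg 0 → ¬ (+ 1 ℤ.+ νℚ (G a) ≤ νℚ (G 0))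
  no-drop-at-steep-minimum G a wg a≤ek Gₐ≢0 (G≥ , _ , _ , W₀≡wg) drop =
    ℕP.<-irrefl refl (ℕP.<-≤-trans (ℕP.≤-<-trans (ℕP.*-monoʳ-≤ n a≤ek) (ℕP.m<m+n (n ℕ.* (e ℕ.* k)) (s≤s z≤n))) Aₙ≤na)
    where
      νₐ = νℚ (G a)
      bound : Steep.Weight≥ a (G a) wg → wg ≤ Steep.weight a (G a)
      bound (inj₁ Gₐ≡0)    = ⊥-elim (Gₐ≢0 Gₐ≡0)
      bound (inj₂ (_ , ≤Wₐ)) = ≤Wₐ
      chain : + Aₙ ℤ.* νₐ ℤ.+ + Aₙ ≤ + Aₙ ℤ.* νₐ ℤ.+ + n ℤ.* + a
      chain = begin
        + Aₙ ℤ.* νₐ ℤ.+ + Aₙ                   ≡⟨ factor (+ Aₙ) νₐ (+ n) ⟩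
        + Aₙ ℤ.* (+ 1 ℤ.+ νₐ) ℤ.+ + n ℤ.* + 0  ≤⟨ +-monoˡ-≤ (+ n ℤ.* + 0) (*-monoˡ-≤-nonNeg (+ Aₙ) drop) ⟩
        + Aₙ ℤ.* νℚ (G 0) ℤ.+ + n ℤ.* + 0      ≡⟨ W₀≡wg ⟩
        wg                                      ≤⟨ bound (G≥ a) ⟩
        + Aₙ ℤ.* νₐ ℤ.+ + n ℤ.* + a            ∎
        where
          open ≤-Reasoning
          factor : ∀ A v n → A ℤ.* v ℤ.+ A ≡ A ℤ.* (+ 1 ℤ.+ v) ℤ.+ n ℤ.* + 0
          factor = ℤSolver.solve-∀
      Aₙ≤na : Aₙ ℕ.≤ n ℕ.* a
      Aₙ≤na = drop‿+≤+ (subst (+ Aₙ ≤_) (sym (pos-* n a)) (+-cancelˡ-≤ (+ Aₙ ℤ.* νₐ) (+ Aₙ) (+ n ℤ.* + a) chain))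

  module _ (m : ℕ) (m-lo : e ℕ.* k ∸ e ℕ.+ 1 ℕ.≤ m) (m-hi : m ℕ.≤ e ℕ.* k)
           (g h : Poly) (g-deg : HasDegree g m) (g*h≈F : (g *ₚ h) ≈ₚ F) where

    private
      G = coeff g
      H = coeff h

      conv≡F : ∀ N → conv G H N ≡ coeff F N
      conv≡F N = trans (sym (coeff-*ₚ g h N)) (g*h≈F N)

      conv≢0 : ∀ N → NZ (conv G H N) → NZ (coeff F N)
      conv≢0 N conv≢0 F≡0 = conv≢0 (trans (cong ↥_ (conv≡F N)) F≡0)

      Gₘ≢0 : NZ (G m)
      Gₘ≢0 Gₘ≡0 = proj₁ g-deg (ℚP.↥p≡0⇒p≡0 (G m) Gₘ≡0)

      H-nonzero : Σ ℕ λ i → NZ (H i)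
      H-nonzero with nonzero-coeff⊎zero h
      ... | inj₁ nonzero = nonzero
      ... | inj₂ h≡0     = ⊥-elim (cₙ≢0 (subst (λ t → ↥ t ≡ 0ℤ) (trans (conv≡F (e ℕ.* n)) F-top)
                                                  (cong ↥_ (conv-zeroʳ G H (e ℕ.* n) h≡0))))

    cofactor-degree : ∀ j → NZ (H j) → j ℕ.+ m ℕ.≤ e ℕ.* n
    cofactor-degree j Hⱼ≢0 with Degree.minWeightAt-exists g (m , Gₘ≢0) | Degree.minWeightAt-exists h H-nonzero
    ... | wg , a , g≥ , g> , g≡ | wh , b , h≥ , h> , h≡ =
      ℕP.≤-trans (ℕP.+-mono-≤ j≤b m≤a) (ℕP.≤-trans (ℕP.≤-reflexive (ℕP.+-comm b a)) a+b≤en)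
      where
        m≤a : m ℕ.≤ a
        m≤a with g≥ m
        ... | inj₁ Gₘ≡0        = ⊥-elim (Gₘ≢0 Gₘ≡0)
        ... | inj₂ (_ , wg≤)   = drop‿+≤+ (neg-cancel-≤ (subst₂ _≤_ (trans (sym (proj₂ g≡)) (degree-weight a (G a))) (degree-weight m (G m)) wg≤))
        j≤b : j ℕ.≤ b
        j≤b with h≥ j
        ... | inj₁ Hⱼ≡0        = ⊥-elim (Hⱼ≢0 Hⱼ≡0)
        ... | inj₂ (_ , wh≤)   = drop‿+≤+ (neg-cancel-≤ (subst₂ _≤_ (trans (sym (proj₂ h≡)) (degree-weight b (H b))) (degree-weight j (H j)) wh≤))
        a+b≤en : a ℕ.+ b ℕ.≤ e ℕ.* n
        a+b≤en with F-index (a ℕ.+ b) (conv≢0 (a ℕ.+ b) (Degree.minimum-nonzero {conv G H} (Degree.minWeightAt-conv G H wg wh a b (g≥ , g> , g≡) (h≥ , h> , h≡))))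
        ... | j′ , j′≤n , a+b≡ , _ = subst (ℕ._≤ e ℕ.* n) (sym a+b≡) (ℕP.*-monoʳ-≤ e j′≤n)

    -- The minimal valuation of F = g·h is at most ν(cₙ) = 0 and is attained at the index a + b,
    -- hence at some e·j with j ≥ i₀; so g attains its minimal valuation first at some a ≥ 1.
    valuation-drops : Σ ℕ λ a → (a ℕ.≤ m) × NZ (G a) × (NZ (G 0) → + 1 ℤ.+ νℚ (G a) ≤ νℚ (G 0))
    valuation-drops with Valuation.minWeightAt-exists g (m , Gₘ≢0) | Valuation.minWeightAt-exists h H-nonzero
    ... | wg , a , g≥ , g> , g≡ | wh , b , h≥ , h> , h≡ = a , a≤m , proj₁ g≡ , G₀-above
      where
        conv-min : Valuation.MinWeightAt (conv G H) (wg ℤ.+ wh) (a ℕ.+ b)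
        conv-min = Valuation.minWeightAt-conv G H wg wh a b (g≥ , g> , g≡) (h≥ , h> , h≡)
        min≤0 : wg ℤ.+ wh ≤ + 0
        min≤0 with proj₁ conv-min (e ℕ.* n)
        ... | inj₁ conv≡0     = ⊥-elim (cₙ≢0 (subst (λ t → ↥ t ≡ 0ℤ) (trans (conv≡F (e ℕ.* n)) F-top) conv≡0))
        ... | inj₂ (_ , min≤) = subst (wg ℤ.+ wh ≤_)
          (trans (valuation-weight (e ℕ.* n) (conv G H (e ℕ.* n))) (trans (cong νℚ (trans (conv≡F (e ℕ.* n)) F-top)) ν-cₙ)) min≤
        1≤a : 1 ℕ.≤ a
        1≤a with F-index (a ℕ.+ b) (conv≢0 (a ℕ.+ b) (Valuation.minimum-nonzero conv-min))
        ... | j , _ , a+b≡ej , F≡cⱼ = index-positive m a b j m-lo a+b≡ej i₀≤j (cofactor-degree b (proj₁ h≡))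
          where
            at-a+b : conv G H (a ℕ.+ b) ≡ c j
            at-a+b = trans (conv≡F (a ℕ.+ b)) F≡cⱼ
            i₀≤j : i₀ ℕ.≤ j
            i₀≤j with j ℕ.<? i₀
            ... | no j≮i₀ = ℕP.≮⇒≥ j≮i₀
            ... | yes j<i₀ = ⊥-elim (<-irrefl refl (≤-<-trans
              (subst (_≤ + 0) (trans (sym (Valuation.minimum-weight conv-min)) (trans (valuation-weight (a ℕ.+ b) (conv G H (a ℕ.+ b))) (cong νℚ at-a+b))) min≤0)
              (suc[i]≤j⇒i<j (ν-below-i₀ j j<i₀ (λ cⱼ≡0 → Valuation.minimum-nonzero conv-min (trans (cong ↥_ at-a+b) cⱼ≡0))))))
        a≤m : a ℕ.≤ m
        a≤m with a ℕ.≤? m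
        ... | yes a≤m = a≤m
        ... | no a≰m  = ⊥-elim (proj₁ g≡ (cong ↥_ (proj₂ g-deg a (ℕP.≰⇒> a≰m))))
        G₀-above : NZ (G 0) → + 1 ℤ.+ νℚ (G a) ≤ νℚ (G 0)
        G₀-above G₀≢0 = above (g> 0 1≤a)
          where
            above : Valuation.Weight> 0 (G 0) wg → + 1 ℤ.+ νℚ (G a) ≤ νℚ (G 0)
            above (inj₁ G₀≡0)          = ⊥-elim (G₀≢0 G₀≡0)
            above (inj₂ (_ , wg<W₀)) = subst (λ t → + 1 ℤ.+ t ≤ νℚ (G 0)) (trans (sym (proj₂ g≡)) (valuation-weight a (G a)))
                                            (subst (ℤ.suc wg ≤_) (valuation-weight 0 (G 0)) wg<W₀)

    -- Since the constant term c₀ of F has the least steep weight, the least steep weight of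
    -- F = g·h is attained first at index 0, and therefore so is that of g.
    steep-minimum-at-0 : Σ ℤ λ wg → Steep.MinWeightAt G wg 0
    steep-minimum-at-0 with Steep.minWeightAt-exists g (m , Gₘ≢0) | Steep.minWeightAt-exists h H-nonzero
    ... | wg , a′ , g-min | wh , b′ , h-min = wg , subst (Steep.MinWeightAt G wg) a′≡0 g-min
      where
        conv-min : Steep.MinWeightAt (conv G H) (wg ℤ.+ wh) (a′ ℕ.+ b′)
        conv-min = Steep.minWeightAt-conv G H wg wh a′ b′ g-min h-min
        c₀≤min : Steep.weight 0 (c 0) ≤ wg ℤ.+ wh
        c₀≤min = subst (Steep.weight 0 (c 0) ≤_)
          (trans (cong (Steep.weight (a′ ℕ.+ b′)) (sym (conv≡F (a′ ℕ.+ b′)))) (Steep.minimum-weight conv-min))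
          (constant-term-minimal (a′ ℕ.+ b′) (conv≢0 (a′ ℕ.+ b′) (Steep.minimum-nonzero conv-min)))
        min<c₀ : 0 ℕ.< a′ ℕ.+ b′ → wg ℤ.+ wh < Steep.weight 0 (c 0)
        min<c₀ 0<a′+b′ with proj₁ (proj₂ conv-min) 0 0<a′+b′
        ... | inj₁ conv₀≡0 = ⊥-elim (c₀≢0 (subst (λ t → ↥ t ≡ 0ℤ) (trans (conv≡F 0) F-bottom) conv₀≡0))
        ... | inj₂ (_ , <) = suc[i]≤j⇒i<j (subst (λ t → ℤ.suc (wg ℤ.+ wh) ≤ Steep.weight 0 t) (trans (conv≡F 0) F-bottom) <)
        a′≡0 : a′ ≡ 0
        a′≡0 with a′ ℕ.+ b′ ℕ.≟ 0
        ... | yes a′+b′≡0 = ℕP.m+n≡0⇒m≡0 a′ a′+b′≡0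
        ... | no a′+b′≢0  = ⊥-elim (<-irrefl refl (<-≤-trans (min<c₀ (ℕP.n≢0⇒n>0 a′+b′≢0)) c₀≤min))

    no-factorisation : ⊥
    no-factorisation =
      let a , a≤m , Gₐ≢0 , G₀-above = valuation-drops
          wg , G-min = steep-minimum-at-0
      in no-drop-at-steep-minimum G a wg (ℕP.≤-trans a≤m m-hi) Gₐ≢0 G-min (G₀-above (Steep.minimum-nonzero G-min))

  no-factor-of-degree : ∀ m → e ℕ.* k ∸ e ℕ.+ 1 ℕ.≤ m → m ℕ.≤ e ℕ.* k → ¬ HasFactorOfDegree F m
  no-factor-of-degree m m-lo m-hi (g , h , g-deg , g*h≈F) = no-factorisation m m-lo m-hi g h g-deg g*h≈F

module NatProduct where

  open import Data.Nat using (zero; suc; _≤_; _<_; z≤n; s≤s)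
  import Data.Nat.Properties as ℕP
  open import Data.Nat.Divisibility using (_∣_; m∣m*n; ∣n⇒∣m*n)
  open import Data.Nat.Primality using (euclidsLemma)
  open import Data.Nat.ListAction using (product)
  open import Data.List using (List; []; _∷_)
  open import Data.List.Relation.Unary.All using (All; []; _∷_)
  open import Data.List.Relation.Unary.AllPairs using (AllPairs; []; _∷_)
  import Data.Integer.Properties as ℤP
  open import Data.Product using (_,_)
  open import Data.Sum using (inj₁; inj₂)
  open import Data.Empty using (⊥-elim)
  open import Relation.Nullary using (yes; no)
  open import Relation.Binary.PropositionalEquality

  rangeList : (ℕ → ℕ) → ℕ → ℕ → List ℕ
  rangeList f lo zero    = []
  rangeList f lo (suc c) = f lo ∷ rangeList f (suc lo) c

  prodFromℕ : (ℕ → ℕ) → ℕ → ℕ → ℕ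
  prodFromℕ f lo c = product (rangeList f lo c)

  prodFrom≡prodFromℕ : ∀ (f : ℕ → ℤ) T → (∀ i → 1 ≤ i → f i ≡ + T i) →
                       ∀ lo c → 1 ≤ lo → prodFrom f lo c ≡ + prodFromℕ T lo c
  prodFrom≡prodFromℕ f T f≡T lo zero    _    = refl
  prodFrom≡prodFromℕ f T f≡T lo (suc c) 1≤lo =
    trans (cong₂ ℤ._*_ (f≡T lo 1≤lo) (prodFrom≡prodFromℕ f T f≡T (suc lo) c (ℕP.m≤n⇒m≤1+n 1≤lo)))
          (sym (ℤP.pos-* (T lo) (prodFromℕ T (suc lo) c)))

  prodFromℕ-+ : ∀ f lo a b → prodFromℕ f lo (a ℕ.+ b) ≡ prodFromℕ f lo a ℕ.* prodFromℕ f (lo ℕ.+ a) b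
  prodFromℕ-+ f lo zero    b = trans (cong (λ t → prodFromℕ f t b) (sym (ℕP.+-identityʳ lo))) (sym (ℕP.+-identityʳ _))
  prodFromℕ-+ f lo (suc a) b =
    trans (cong (f lo ℕ.*_) (trans (prodFromℕ-+ f (suc lo) a b) (cong (λ t → prodFromℕ f (suc lo) a ℕ.* prodFromℕ f t b) (sym (ℕP.+-suc lo a)))))
          (sym (ℕP.*-assoc (f lo) _ _))

  prodFromℕ-pos : ∀ f lo c → (∀ i → lo ≤ i → 1 ≤ f i) → 1 ≤ prodFromℕ f lo c
  prodFromℕ-pos f lo zero    f-pos = s≤s z≤n
  prodFromℕ-pos f lo (suc c) f-pos =
    ℕP.*-mono-≤ (f-pos lo ℕP.≤-refl) (prodFromℕ-pos f (suc lo) c (λ i lo<i → f-pos i (ℕP.<⇒≤ lo<i)))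

  ∣prodFromℕ : ∀ f lo c i → lo ≤ i → i < lo ℕ.+ c → f i ∣ prodFromℕ f lo c
  ∣prodFromℕ f lo zero    i lo≤i i< = ⊥-elim (ℕP.<-irrefl refl (ℕP.<-≤-trans i< (ℕP.≤-trans (ℕP.≤-reflexive (ℕP.+-identityʳ lo)) lo≤i)))
  ∣prodFromℕ f lo (suc c) i lo≤i i< with lo ℕ.≟ i
  ... | yes refl = m∣m*n (prodFromℕ f (suc lo) c)
  ... | no lo≢i  = ∣n⇒∣m*n (f lo) (∣prodFromℕ f (suc lo) c i (ℕP.≤∧≢⇒< lo≤i lo≢i) (ℕP.≤-trans i< (ℕP.≤-reflexive (ℕP.+-suc lo c))))

  prime∣prodFromℕ : ∀ {p} → Prime p → ∀ f lo c → p ∣ prodFromℕ f lo c → Σ ℕ λ i → lo ≤ i × i < lo ℕ.+ c × p ∣ f i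
  prime∣prodFromℕ p-prime f lo zero    p∣1 = ⊥-elim (NatValuation.p∤1 _ p-prime p∣1)
  prime∣prodFromℕ p-prime f lo (suc c) p∣ with euclidsLemma (f lo) (prodFromℕ f (suc lo) c) p-prime p∣
  ... | inj₁ p∣f = lo , ℕP.≤-refl , ℕP.m<m+n lo (s≤s z≤n) , p∣f
  ... | inj₂ p∣rest with prime∣prodFromℕ p-prime f (suc lo) c p∣rest
  ... | i , lo<i , i< , p∣fᵢ = i , ℕP.<⇒≤ lo<i , ℕP.≤-trans i< (ℕP.≤-reflexive (sym (ℕP.+-suc lo c))) , p∣fᵢ

  rangeList-sorted : ∀ f lo c → (∀ i j → lo ≤ i → i < j → f i < f j) → AllPairs _<_ (rangeList f lo c)
  rangeList-sorted f lo zero    f-inc = []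
  rangeList-sorted f lo (suc c) f-inc =
    above (suc lo) c ℕP.≤-refl ∷ rangeList-sorted f (suc lo) c (λ i j lo<i → f-inc i j (ℕP.<⇒≤ lo<i))
    where
      above : ∀ lo′ c′ → lo < lo′ → All (f lo <_) (rangeList f lo′ c′)
      above lo′ zero     _      = []
      above lo′ (suc c′) lo<lo′ = f-inc lo lo′ ℕP.≤-refl lo<lo′ ∷ above (suc lo′) c′ (ℕP.m≤n⇒m≤1+n lo<lo′)

  rangeList-range : ∀ f lo c M → (∀ i → lo ≤ i → 1 ≤ f i) → (∀ i → lo ≤ i → i < lo ℕ.+ c → f i ≤ M) →
                    All (λ x → 1 ≤ x × x ≤ M) (rangeList f lo c)
  rangeList-range f lo zero    M f-pos f≤M = []
  rangeList-range f lo (suc c) M f-pos f≤M =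
    (f-pos lo ℕP.≤-refl , f≤M lo ℕP.≤-refl (ℕP.m<m+n lo (s≤s z≤n)))
    ∷ rangeList-range f (suc lo) c M (λ i lo<i → f-pos i (ℕP.<⇒≤ lo<i))
        (λ i lo<i i< → f≤M i (ℕP.<⇒≤ lo<i) (ℕP.≤-trans i< (ℕP.≤-reflexive (sym (ℕP.+-suc lo c)))))

module Legendre (p : ℕ) (p-prime : Prime p) where

  open import Data.Nat using (zero; suc; _∸_; _≤_; _<_; z≤n; s≤s)
  import Data.Nat.Properties as ℕP
  open import Data.Nat.Divisibility using (divides; _∣?_)
  open import Data.Nat.DivMod using (_/_; m*n/n≡m; /-monoˡ-≤; m/n*n≤m; m/n<m)
  open import Data.List using (List; []; _∷_; length)
  open import Data.Nat.ListAction using (product)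
  open import Data.List.Relation.Unary.All as All using (All; []; _∷_)
  open import Data.List.Relation.Unary.AllPairs using (AllPairs; []; _∷_)
  open import Data.Product using (_,_; proj₁)
  open import Data.Empty using (⊥-elim)
  open import Relation.Nullary using (Dec; yes; no)
  open import Relation.Binary.PropositionalEquality
  open import Data.Nat.Tactic.RingSolver using (solve-∀)
  open NatProduct using (prodFromℕ; rangeList; rangeList-sorted; rangeList-range)
  open NatValuation p p-prime

  InRange : ℕ → List ℕ → Set
  InRange M = All (λ x → 1 ≤ x × x ≤ M)

  private
    ≢0 : ∀ {x} → 1 ≤ x → x ≢ 0
    ≢0 (s≤s _) ()

    product-pos : ∀ xs → All (1 ≤_) xs → 1 ≤ product xs
    product-pos []       []         = s≤s z≤n
    product-pos (x ∷ xs) (1≤x ∷ 1≤) = ℕP.*-mono-≤ 1≤x (product-pos xs 1≤)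

    length-≤ : ∀ xs lo M → AllPairs _<_ xs → All (λ x → lo ≤ x × x ≤ M) xs → length xs ≤ suc M ∸ lo
    length-≤ []       lo M _              _                   = z≤n
    length-≤ (x ∷ xs) lo M (x< ∷ sorted) ((lo≤x , x≤M) ∷ rng) =
      ℕP.≤-trans (s≤s (ℕP.≤-trans (length-≤ xs (suc x) M sorted (narrow x< rng)) (ℕP.∸-monoʳ-≤ M lo≤x)))
                 (ℕP.≤-reflexive (sym (ℕP.+-∸-assoc 1 (ℕP.≤-trans lo≤x x≤M))))
      where
        narrow : ∀ {ys} → All (x <_) ys → All (λ y → lo ≤ y × y ≤ M) ys → All (λ y → suc x ≤ y × y ≤ M) ys
        narrow []         []              = []
        narrow (x<y ∷ x<) ((_ , y≤M) ∷ r) = (x<y , y≤M) ∷ narrow x< r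

  quotients : List ℕ → List ℕ
  quotients []       = []
  quotients (x ∷ xs) with p ∣? x
  ... | yes (divides q _) = q ∷ quotients xs
  ... | no _              = quotients xs

  private
    quotients-pos : ∀ xs → All (1 ≤_) xs → All (1 ≤_) (quotients xs)
    quotients-pos []       []          = []
    quotients-pos (x ∷ xs) (1≤x ∷ 1≤) with p ∣? x
    ... | no _                  = quotients-pos xs 1≤
    ... | yes (divides q refl) = ℕP.n≢0⇒n>0 (λ { refl → ≢0 1≤x refl }) ∷ quotients-pos xs 1≤

    quotients-range : ∀ xs M → InRange M xs → InRange (M / p) (quotients xs)
    quotients-range []       M []                   = []
    quotients-range (x ∷ xs) M ((1≤x , x≤M) ∷ rng) with p ∣? x
    ... | no _                 = quotients-range xs M rng
    ... | yes (divides q refl) =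
      (ℕP.n≢0⇒n>0 (λ { refl → ≢0 1≤x refl }) , ℕP.≤-trans (ℕP.≤-reflexive (sym (m*n/n≡m q p))) (/-monoˡ-≤ p x≤M))
      ∷ quotients-range xs M rng

    quotients-> : ∀ q xs → All (q ℕ.* p <_) xs → All (q <_) (quotients xs)
    quotients-> q []       []          = []
    quotients-> q (x ∷ xs) (qp<x ∷ qp<) with p ∣? x
    ... | no _                 = quotients-> q xs qp<
    ... | yes (divides r refl) = ℕP.*-cancelʳ-< p q r qp<x ∷ quotients-> q xs qp<

    quotients-sorted : ∀ xs → AllPairs _<_ xs → AllPairs _<_ (quotients xs)
    quotients-sorted []       []              = []
    quotients-sorted (x ∷ xs) (x< ∷ sorted) with p ∣? x
    ... | no _                 = quotients-sorted xs sorted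
    ... | yes (divides q refl) = quotients-> q xs x< ∷ quotients-sorted xs sorted

  -- each multiple of p contributes one factor p and its quotient
  ν-product : ∀ xs → All (1 ≤_) xs → ν (product xs) ≡ length (quotients xs) ℕ.+ ν (product (quotients xs))
  ν-product []       []          = refl
  ν-product (x ∷ xs) (1≤x ∷ 1≤) with p ∣? x | ν-* x (product xs) (≢0 1≤x) (≢0 (product-pos xs 1≤))
  ... | no p∤x                | ν-x*xs = trans ν-x*xs (trans (cong (ℕ._+ ν (product xs)) (p∤n⇒ν≡0 x p∤x)) (ν-product xs 1≤))
  ... | yes (divides q refl) | ν-x*xs =
    trans ν-x*xs (trans (cong₂ ℕ._+_ (trans (ν-* q p q≢0 (≢0 (ℕP.≤-trans (s≤s z≤n) p≥2))) (cong (ν q ℕ.+_) ν-p)) (ν-product xs 1≤))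
      (trans (regroup (ν q) (length (quotients xs)) (ν (product (quotients xs))))
        (cong (λ t → suc (length (quotients xs) ℕ.+ t)) (sym (ν-* q (product (quotients xs)) q≢0 (≢0 (product-pos _ (quotients-pos xs 1≤))))))))
    where
      q≢0 : q ≢ 0
      q≢0 refl = ≢0 1≤x refl
      regroup : ∀ a b c → a ℕ.+ 1 ℕ.+ (b ℕ.+ c) ≡ suc (b ℕ.+ (a ℕ.+ c))
      regroup = solve-∀

  private
    legendre-fuel : ∀ f M xs → M ≤ f → 1 ≤ M → AllPairs _<_ xs → InRange M xs → (p ∸ 1) ℕ.* ν (product xs) < M
    legendre-fuel zero    M xs M≤0 1≤M _      _   = ⊥-elim (ℕP.<-irrefl refl (ℕP.≤-trans 1≤M M≤0))
    legendre-fuel (suc f) M xs M≤f 1≤M sorted rng with M / p ℕ.≟ 0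
    ... | yes M/p≡0 = subst (λ t → (p ∸ 1) ℕ.* t < M) (sym ν≡0) (subst (_< M) (sym (ℕP.*-zeroʳ (p ∸ 1))) 1≤M)
      where
        no-quotients : quotients xs ≡ []
        no-quotients with quotients xs | quotients-range xs M rng
        ... | []    | _               = refl
        ... | y ∷ _ | (1≤y , y≤) ∷ _ = ⊥-elim (ℕP.<-irrefl refl (ℕP.≤-trans 1≤y (subst (y ≤_) M/p≡0 y≤)))
        ν≡0 : ν (product xs) ≡ 0
        ν≡0 = trans (ν-product xs (All.map proj₁ rng))
                    (trans (cong (λ ys → length ys ℕ.+ ν (product ys)) no-quotients) ν-1)
    ... | no M/p≢0 = ℕP.<-≤-trans bound (m/n*n≤m M p)
      where
        M′ = M / p
        p′ = p ∸ 1
        qs = quotients xs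
        M′<M : M′ < M
        M′<M = m/n<m M p {{ℕ.>-nonZero 1≤M}} p≥2
        IH : p′ ℕ.* ν (product qs) < M′
        IH = legendre-fuel f M′ qs (ℕP.≤-pred (ℕP.≤-trans M′<M M≤f)) (ℕP.n≢0⇒n>0 M/p≢0)
               (quotients-sorted xs sorted) (quotients-range xs M rng)
        length≤ : length qs ≤ M′
        length≤ = length-≤ qs 1 M′ (quotients-sorted xs sorted) (quotients-range xs M rng)
        p≡1+p′ : p ≡ suc p′
        p≡1+p′ = sym (ℕP.m+[n∸m]≡n (ℕP.≤-trans (s≤s z≤n) p≥2))
        collect : ∀ a b → a ℕ.* b ℕ.+ b ≡ b ℕ.* suc a
        collect = solve-∀
        bound : p′ ℕ.* ν (product xs) < M′ ℕ.* p
        bound = begin-strict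
          p′ ℕ.* ν (product xs)                          ≡⟨ cong (p′ ℕ.*_) (ν-product xs (All.map proj₁ rng)) ⟩
          p′ ℕ.* (length qs ℕ.+ ν (product qs))          ≡⟨ ℕP.*-distribˡ-+ p′ _ _ ⟩
          p′ ℕ.* length qs ℕ.+ p′ ℕ.* ν (product qs)     <⟨ ℕP.+-mono-≤-< (ℕP.*-monoʳ-≤ p′ length≤) IH ⟩
          p′ ℕ.* M′ ℕ.+ M′                               ≡⟨ collect p′ M′ ⟩
          M′ ℕ.* suc p′                                  ≡⟨ cong (M′ ℕ.*_) p≡1+p′ ⟨
          M′ ℕ.* p                                       ∎
          where open ℕP.≤-Reasoning

  -- ν(x₁ ⋯ xᵣ) ≤ ν(M!) < M / (p − 1) for distinct x₁, …, xᵣ ∈ [1, M]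
  legendre : ∀ M xs → 1 ≤ M → AllPairs _<_ xs → InRange M xs → (p ∸ 1) ℕ.* ν (product xs) < M
  legendre M xs = legendre-fuel M M xs ℕP.≤-refl

  -- Below k the factors are smaller than p; from k on, Legendre gives (p − 1)·ν < T j ≤ j (p − 1) / k.
  k*ν-prodFromℕ<j : ∀ (T : ℕ → ℕ) k → 1 ≤ k → (∀ i → 1 ≤ i → 1 ≤ T i) → (∀ i j → 1 ≤ i → i < j → T i < T j) →
                    (∀ j → 1 ≤ j → j ≤ k → T j < p) → (∀ j → k ≤ j → k ℕ.* T j ≤ j ℕ.* (p ∸ 1)) →
                    ∀ j → 1 ≤ j → k ℕ.* ν (prodFromℕ T 1 j) < j
  k*ν-prodFromℕ<j T k 1≤k T-pos T-inc T-small T-big j 1≤j = by-cases (j ℕ.≤? k)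
    where
      p′ = p ∸ 1
      V = ν (prodFromℕ T 1 j)
      T-mono : ∀ i → 1 ≤ i → i < suc j → T i ≤ T j
      T-mono i 1≤i (s≤s i≤j) with i ℕ.≟ j
      ... | yes refl = ℕP.≤-refl
      ... | no i≢j   = ℕP.<⇒≤ (T-inc i j 1≤i (ℕP.≤∧≢⇒< i≤j i≢j))
      bound : p′ ℕ.* V < T j
      bound = legendre (T j) (rangeList T 1 j) (T-pos j 1≤j) (rangeList-sorted T 1 j T-inc)
                       (rangeList-range T 1 j (T j) T-pos T-mono)
      by-cases : Dec (j ≤ k) → k ℕ.* V < j
      by-cases (yes j≤k) = small V bound
        where
          Tⱼ≤p′ : T j ≤ p′
          Tⱼ≤p′ = ℕP.≤-pred (subst (suc (T j) ≤_) (sym (ℕP.m+[n∸m]≡n (ℕP.≤-trans (s≤s z≤n) p≥2))) (T-small j 1≤j j≤k))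
          small : ∀ V → p′ ℕ.* V < T j → k ℕ.* V < j
          small zero     _      = subst (_< j) (sym (ℕP.*-zeroʳ k)) 1≤j
          small (suc V′) p′V<Tⱼ = ⊥-elim (ℕP.<-irrefl refl (ℕP.<-≤-trans p′V<Tⱼ (ℕP.≤-trans Tⱼ≤p′ (ℕP.m≤m*n p′ (suc V′)))))
      by-cases (no j≰k) = ℕP.*-cancelʳ-< p′ (k ℕ.* V) j (subst (_< j ℕ.* p′) (shuffle k V p′)
                            (ℕP.<-≤-trans (ℕP.*-monoʳ-< k {{ℕ.>-nonZero 1≤k}} bound) (T-big j (ℕP.<⇒≤ (ℕP.≰⇒> j≰k)))))
        where
          shuffle : ∀ k V p → k ℕ.* (p ℕ.* V) ≡ k ℕ.* V ℕ.* p
          shuffle = solve-∀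

module CoefficientValuation (p : ℕ) (p-prime : Prime p) (u : ℤ) (α d n : ℕ) (a : ℕ → ℤ) (T : ℕ → ℕ)
  (T≡ : ∀ i → 1 ℕ.≤ i → + α ℤ.+ (u ℤ.+ + i) ℤ.* + d ≡ + T i)
  (T-pos : ∀ i → 1 ℕ.≤ i → 1 ℕ.≤ T i) where

  open import Data.Nat using (suc; _∸_; _≤_; _<_; z≤n; s≤s)
  import Data.Nat.Properties as ℕP
  open import Data.Nat.Divisibility using (_∣_; ∣-trans; ∣n⇒∣m*n)
  open import Data.Integer using (+_; ∣_∣; 0ℤ; +≤+; +<+)
  import Data.Integer.Properties as ℤP
  open import Data.Rational using (↥_)
  open import Data.Product using (_,_; proj₁; proj₂)
  open import Data.Sum using (inj₁; inj₂)
  open import Relation.Nullary using (¬_)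
  open import Relation.Binary.PropositionalEquality
  import Data.Integer.Tactic.RingSolver as ℤSolver
  open NatProduct
  open Polynomial using (coeff-map-applyUpTo; coeff-map-applyUpTo-≥)
  open RatValuation p p-prime

  c : ℕ → ℚ
  c j = GqCoeff u α d n a j ℚ./ 1

  coeff-Gq : ∀ N → N ≤ n → coeff (Gq u α d n a) N ≡ c N
  coeff-Gq N N≤n = coeff-map-applyUpTo _ (λ x → x) (suc n) N (s≤s N≤n)

  coeff-Gq-> : ∀ N → n < N → coeff (Gq u α d n a) N ≡ ℚ.0ℚ
  coeff-Gq-> N n<N = coeff-map-applyUpTo-≥ _ (λ x → x) (suc n) N n<N

  GqCoeff≡ : ∀ j → GqCoeff u α d n a j ≡ a j ℤ.* + prodFromℕ T (suc j) (n ∸ j)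
  GqCoeff≡ j = cong (a j ℤ.*_) (prodFrom≡prodFromℕ _ T T≡ (suc j) (n ∸ j) (s≤s z≤n))

  private
    T-prod-pos : ∀ lo c → 1 ≤ lo → 1 ≤ prodFromℕ T lo c
    T-prod-pos lo c 1≤lo = prodFromℕ-pos T lo c (λ i lo≤i → T-pos i (ℕP.≤-trans 1≤lo lo≤i))

    pos≢0 : ∀ {m} → 1 ≤ m → + m ≢ 0ℤ
    pos≢0 (s≤s _) ()

    *-pos≢0 : ∀ z m → z ≢ 0ℤ → 1 ≤ m → z ℤ.* + m ≢ 0ℤ
    *-pos≢0 z m z≢0 1≤m zm≡0 with ℤP.i*j≡0⇒i≡0∨j≡0 z zm≡0
    ... | inj₁ z≡0 = z≢0 z≡0
    ... | inj₂ m≡0 = pos≢0 1≤m m≡0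

    ↥≢0⇒≢0 : ∀ z → NZ (z ℚ./ 1) → z ≢ 0ℤ
    ↥≢0⇒≢0 .(+ 0) z/1≢0 refl = z/1≢0 refl

    GqCoeffₙ≡ : GqCoeff u α d n a n ≡ a n
    GqCoeffₙ≡ = trans (GqCoeff≡ n) (trans (cong (λ x → a n ℤ.* + prodFromℕ T (suc n) x) (ℕP.n∸n≡0 n)) (ℤP.*-identityʳ (a n)))

  cₙ≢0 : a n ≢ 0ℤ → NZ (c n)
  cₙ≢0 aₙ≢0 = proj₁ (νℚ-fromℤ _ (subst (_≢ 0ℤ) (sym GqCoeffₙ≡) aₙ≢0))

  ν-cₙ : a n ≢ 0ℤ → ¬ p ∣ ∣ a n ∣ → νℚ (c n) ≡ + 0
  ν-cₙ aₙ≢0 p∤aₙ = trans (proj₂ (νℚ-fromℤ _ (subst (_≢ 0ℤ) (sym GqCoeffₙ≡) aₙ≢0)))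
                          (cong +_ (trans (cong νℤ GqCoeffₙ≡) (p∤n⇒ν≡0 ∣ a n ∣ p∤aₙ)))

  c₀≢0 : a 0 ≢ 0ℤ → NZ (c 0)
  c₀≢0 a₀≢0 = proj₁ (νℚ-fromℤ _ (subst (_≢ 0ℤ) (sym (GqCoeff≡ 0)) (*-pos≢0 (a 0) _ a₀≢0 (T-prod-pos 1 n ℕP.≤-refl))))

  -- for j < i₀ the product defining the j-th coefficient contains the factor T i₀
  ν-below-i₀ : ∀ i₀ → i₀ ≤ n → p ∣ T i₀ → ∀ j → j < i₀ → NZ (c j) → + 1 ℤ.≤ νℚ (c j)
  ν-below-i₀ i₀ i₀≤n p∣Tᵢ₀ j j<i₀ cⱼ≢0 =
    subst (+ 1 ℤ.≤_) (sym (proj₂ (νℚ-fromℤ _ Gⱼ≢0))) (+≤+ (p∣n⇒1≤ν _ (∣∣≢0 {GqCoeff u α d n a j} Gⱼ≢0) p∣Gⱼ))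
    where
      Gⱼ≢0 = ↥≢0⇒≢0 _ cⱼ≢0
      i₀<1+j+[n∸j] : i₀ < suc j ℕ.+ (n ∸ j)
      i₀<1+j+[n∸j] = s≤s (ℕP.≤-trans i₀≤n (ℕP.≤-reflexive (sym (ℕP.m+[n∸m]≡n (ℕP.≤-trans (ℕP.<⇒≤ j<i₀) i₀≤n)))))
      p∣Gⱼ : p ∣ ∣ GqCoeff u α d n a j ∣
      p∣Gⱼ = subst (λ x → p ∣ ∣ x ∣) (sym (GqCoeff≡ j))
               (subst (p ∣_) (sym (ℤP.abs-* (a j) (+ prodFromℕ T (suc j) (n ∸ j))))
                 (∣n⇒∣m*n ∣ a j ∣ (∣-trans p∣Tᵢ₀ (∣prodFromℕ T (suc j) (n ∸ j) i₀ j<i₀ i₀<1+j+[n∸j]))))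

  -- ν(c₀) − ν(cⱼ) ≤ ν(T 1 ⋯ T j) as p ∤ a₀
  slope : ∀ k → a 0 ≢ 0ℤ → ¬ p ∣ ∣ a 0 ∣ → (∀ j → 1 ≤ j → k ℕ.* ν (prodFromℕ T 1 j) < j) →
          ∀ j → 1 ≤ j → j ≤ n → NZ (c j) → + k ℤ.* (νℚ (c 0) ℤ.- νℚ (c j)) ℤ.< + j
  slope k a₀≢0 p∤a₀ kν<j j 1≤j j≤n cⱼ≢0 = ℤP.≤-<-trans k*diff≤kV (+<+ (kν<j j 1≤j))
    where
      V = ν (prodFromℕ T 1 j)
      X = ν (prodFromℕ T (suc j) (n ∸ j))
      Gⱼ≢0 = ↥≢0⇒≢0 (GqCoeff u α d n a j) cⱼ≢0
      aⱼ≢0 : a j ≢ 0ℤ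
      aⱼ≢0 aⱼ≡0 = Gⱼ≢0 (trans (GqCoeff≡ j) (cong (ℤ._* + prodFromℕ T (suc j) (n ∸ j)) aⱼ≡0))
      split : prodFromℕ T 1 n ≡ prodFromℕ T 1 j ℕ.* prodFromℕ T (suc j) (n ∸ j)
      split = trans (cong (prodFromℕ T 1) (sym (ℕP.m+[n∸m]≡n j≤n))) (prodFromℕ-+ T 1 j (n ∸ j))
      ν₀ : νℚ (c 0) ≡ + (V ℕ.+ X)
      ν₀ = trans (proj₂ (νℚ-fromℤ (GqCoeff u α d n a 0) (↥≢0⇒≢0 (GqCoeff u α d n a 0) (c₀≢0 a₀≢0))))
             (cong +_ (trans (cong νℤ (GqCoeff≡ 0)) (trans (νℤ-* (a 0) _ a₀≢0 (pos≢0 (T-prod-pos 1 n ℕP.≤-refl)))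
               (trans (cong₂ ℕ._+_ (p∤n⇒ν≡0 ∣ a 0 ∣ p∤a₀) (cong ν split))
                 (ν-* _ _ (λ eq → ℕP.<-irrefl (sym eq) (T-prod-pos 1 j ℕP.≤-refl))
                          (λ eq → ℕP.<-irrefl (sym eq) (T-prod-pos (suc j) (n ∸ j) (s≤s z≤n))))))))
      νⱼ : νℚ (c j) ≡ + (νℤ (a j) ℕ.+ X)
      νⱼ = trans (proj₂ (νℚ-fromℤ _ Gⱼ≢0)) (cong +_ (trans (cong νℤ (GqCoeff≡ j))
             (νℤ-* (a j) _ aⱼ≢0 (pos≢0 (T-prod-pos (suc j) (n ∸ j) (s≤s z≤n))))))
      diff≤V : νℚ (c 0) ℤ.- νℚ (c j) ℤ.≤ + V
      diff≤V = subst (ℤ._≤ + V) (sym (trans (cong₂ ℤ._-_ ν₀ νⱼ) (cancel V X (νℤ (a j))))) (ℤP.i-j≤i (+ V) (+ νℤ (a j)))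
        where
          cancel : ∀ V X Y → + (V ℕ.+ X) ℤ.- + (Y ℕ.+ X) ≡ + V ℤ.- + Y
          cancel V X Y = trans (cong₂ ℤ._-_ (ℤP.pos-+ V X) (ℤP.pos-+ Y X)) (solve (+ V) (+ X) (+ Y))
            where
              solve : ∀ a b c → a ℤ.+ b ℤ.- (c ℤ.+ b) ≡ a ℤ.- c
              solve = ℤSolver.solve-∀
      k*diff≤kV : + k ℤ.* (νℚ (c 0) ℤ.- νℚ (c j)) ℤ.≤ + (k ℕ.* V)
      k*diff≤kV = subst (+ k ℤ.* (νℚ (c 0) ℤ.- νℚ (c j)) ℤ.≤_) (sym (ℤP.pos-* k V)) (ℤP.*-monoˡ-≤-nonNeg (+ k) diff≤V)

module GreatestPrimeFactor where

  open import Data.Nat using (suc; _≤_)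
  import Data.Nat.Properties as ℕP
  open import Data.Nat.Divisibility using (_∣_; _∣?_)
  open import Data.Nat.Primality using (prime?; prime⇒nonTrivial)
  open import Data.Product using (_,_)
  open import Data.Sum using (inj₁; inj₂)
  open import Relation.Nullary using (yes; no)
  open import Data.Empty using (⊥-elim)
  open import Relation.Binary.PropositionalEquality using (refl; subst)

  gpfBelow≡1⊎prime∣ : ∀ m i → (gpfBelow m i ≡ 1) ⊎ (Prime (gpfBelow m i) × gpfBelow m i ∣ m)
  gpfBelow≡1⊎prime∣ m ℕ.zero = inj₁ refl
  gpfBelow≡1⊎prime∣ m (suc i) with prime? (suc i) | suc i ∣? m
  ... | yes 1+i-prime | yes ∣m = inj₂ (1+i-prime , ∣m)
  ... | yes _         | no _   = gpfBelow≡1⊎prime∣ m i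
  ... | no _          | _      = gpfBelow≡1⊎prime∣ m i

  prime∣⇒≤gpfBelow : ∀ m i q → Prime q → q ∣ m → q ≤ i → q ≤ gpfBelow m i
  prime∣⇒≤gpfBelow m ℕ.zero q q-prime q∣m q≤0
    with () ← ℕP.≤-trans (ℕ.nonTrivial⇒n>1 q {{prime⇒nonTrivial q-prime}}) q≤0
  prime∣⇒≤gpfBelow m (suc i) q q-prime q∣m q≤1+i with prime? (suc i) | suc i ∣? m
  ... | yes _ | yes _     = q≤1+i
  ... | yes _ | no 1+i∤m  = prime∣⇒≤gpfBelow m i q q-prime q∣m (ℕP.≤-pred (ℕP.≤∧≢⇒< q≤1+i (λ { refl → 1+i∤m q∣m })))
  ... | no ¬prime | _     = prime∣⇒≤gpfBelow m i q q-prime q∣m (ℕP.≤-pred (ℕP.≤∧≢⇒< q≤1+i (λ { refl → ¬prime q-prime })))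

  large-prime-factor : ∀ D m → 1 ≤ D → D ℕ.< gpfBelow m m → Σ ℕ λ p → Prime p × p ∣ m × D ℕ.< p
  large-prime-factor D m 1≤D D<P with gpfBelow≡1⊎prime∣ m m
  ... | inj₁ P≡1 = ⊥-elim (ℕP.<-irrefl refl (ℕP.<-≤-trans (subst (D ℕ.<_) P≡1 D<P) 1≤D))
  ... | inj₂ (P-prime , P∣m) = gpfBelow m m , P-prime , P∣m , D<P

-- For q = −s + α/d the factors α + (u + i)·d of G_q are α + d·(i − s).
module Progression where

  open import Data.Nat using (suc; _∸_; _≤_; _<_; z≤n; s≤s)
  import Data.Nat.Properties as ℕP
  open import Data.Nat.Divisibility using (_∣_; ∣-trans; ∣⇒≤; m∣m*n; n∣m*n)
  import Data.Integer.Properties as ℤP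
  open import Data.Product using (_,_)
  open import Relation.Nullary using (¬_)
  open import Relation.Binary.PropositionalEquality
  open import Data.Nat.Tactic.RingSolver using (solve-∀)
  open NatProduct
  open GreatestPrimeFactor
  open Polynomial using (support; support-at; substXPow-support; substXPow-support-at)

  progression : ℕ → ℕ → ℕ → ℕ → ℕ
  progression s α d i = α ℕ.+ d ℕ.* (i ∸ s)

  progression-pos : ∀ s α d → 1 ≤ α → ∀ i → 1 ≤ progression s α d i
  progression-pos s α d 1≤α i = ℕP.≤-trans 1≤α (ℕP.m≤m+n α (d ℕ.* (i ∸ s)))

  progression-< : ∀ {s} α d → s ≤ 1 → 1 ≤ d → ∀ i j → 1 ≤ i → i < j → progression s α d i < progression s α d j
  progression-< α d s≤1 1≤d i j 1≤i i<j =
    ℕP.+-monoʳ-< α (ℕP.*-monoʳ-< d {{ℕ.>-nonZero 1≤d}} (ℕP.∸-monoˡ-< i<j (ℕP.≤-trans s≤1 1≤i)))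

  private
    progression≤d*[1+i∸s] : ∀ {s} α d i → α ≤ d → s ≤ i → progression s α d i ≤ d ℕ.* (suc i ∸ s)
    progression≤d*[1+i∸s] {s} α d i α≤d s≤i = begin
      α ℕ.+ d ℕ.* (i ∸ s)  ≤⟨ ℕP.+-monoˡ-≤ (d ℕ.* (i ∸ s)) α≤d ⟩
      d ℕ.+ d ℕ.* (i ∸ s)  ≡⟨ ℕP.*-suc d (i ∸ s) ⟨
      d ℕ.* suc (i ∸ s)    ≡⟨ cong (d ℕ.*_) (ℕP.+-∸-assoc 1 s≤i) ⟨
      d ℕ.* (suc i ∸ s)    ∎
      where open ℕP.≤-Reasoning

    -- (j − k)(1 − s) ≥ 0
    k*[1+j∸s]≤j*[1+k∸s] : ∀ {s} k j → s ≤ 1 → k ≤ j → k ℕ.* (suc j ∸ s) ≤ j ℕ.* (suc k ∸ s)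
    k*[1+j∸s]≤j*[1+k∸s] k j z≤n k≤j = begin
      k ℕ.* suc j      ≡⟨ ℕP.*-suc k j ⟩
      k ℕ.+ k ℕ.* j    ≤⟨ ℕP.+-monoˡ-≤ (k ℕ.* j) k≤j ⟩
      j ℕ.+ k ℕ.* j    ≡⟨ cong (j ℕ.+_) (ℕP.*-comm k j) ⟩
      j ℕ.+ j ℕ.* k    ≡⟨ ℕP.*-suc j k ⟨
      j ℕ.* suc k      ∎
      where open ℕP.≤-Reasoning
    k*[1+j∸s]≤j*[1+k∸s] k j (s≤s z≤n) k≤j = ℕP.≤-reflexive (ℕP.*-comm k j)

  progression-≤-small : ∀ {s} α d k → s ≤ 1 → α ≤ d → ∀ j → 1 ≤ j → j ≤ k → progression s α d j ≤ d ℕ.* (suc k ∸ s)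
  progression-≤-small {s} α d k s≤1 α≤d j 1≤j j≤k =
    ℕP.≤-trans (progression≤d*[1+i∸s] α d j α≤d (ℕP.≤-trans s≤1 1≤j)) (ℕP.*-monoʳ-≤ d (ℕP.∸-monoˡ-≤ s (s≤s j≤k)))

  progression-≤-large : ∀ {s} α d k → s ≤ 1 → α ≤ d → 1 ≤ k → ∀ j → k ≤ j →
                        k ℕ.* progression s α d j ≤ j ℕ.* (d ℕ.* (suc k ∸ s))
  progression-≤-large {s} α d k s≤1 α≤d 1≤k j k≤j = begin
    k ℕ.* progression s α d j      ≤⟨ ℕP.*-monoʳ-≤ k (progression≤d*[1+i∸s] α d j α≤d (ℕP.≤-trans s≤1 (ℕP.≤-trans 1≤k k≤j))) ⟩
    k ℕ.* (d ℕ.* (suc j ∸ s))      ≡⟨ swap k d (suc j ∸ s) ⟩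
    d ℕ.* (k ℕ.* (suc j ∸ s))      ≤⟨ ℕP.*-monoʳ-≤ d (k*[1+j∸s]≤j*[1+k∸s] k j s≤1 k≤j) ⟩
    d ℕ.* (j ℕ.* (suc k ∸ s))      ≡⟨ swap d j (suc k ∸ s) ⟩
    j ℕ.* (d ℕ.* (suc k ∸ s))      ∎
    where
      open ℕP.≤-Reasoning
      swap : ∀ a b c → a ℕ.* (b ℕ.* c) ≡ b ℕ.* (a ℕ.* c)
      swap = solve-∀

  private
    -[s]+i≡+[i∸s] : ∀ s i → s ≤ i → ℤ.- + s ℤ.+ + i ≡ + (i ∸ s)
    -[s]+i≡+[i∸s] s i s≤i = trans (ℤP.-m+n≡n⊖m s i) (ℤP.⊖-≥ s≤i)

  progression-≡ : ∀ s α d → s ≤ 1 → ∀ i → 1 ≤ i →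
                  + α ℤ.+ (ℤ.- + s ℤ.+ + i) ℤ.* + d ≡ + progression s α d i
  progression-≡ s α d s≤1 i 1≤i =
    trans (cong (λ t → + α ℤ.+ t ℤ.* + d) (-[s]+i≡+[i∸s] s i (ℕP.≤-trans s≤1 1≤i)))
          (trans (cong (λ t → + α ℤ.+ t) (trans (sym (ℤP.pos-* (i ∸ s) d)) (cong +_ (ℕP.*-comm (i ∸ s) d))))
                 (sym (ℤP.pos-+ α (d ℕ.* (i ∸ s)))))

  progression-≡′ : ∀ s α d → s ≤ 1 → ∀ i → 1 ≤ i →
                   + α ℤ.+ + d ℤ.* (ℤ.- + s ℤ.+ + i) ≡ + progression s α d i
  progression-≡′ s α d s≤1 i 1≤i =
    trans (cong (λ t → + α ℤ.+ t) (ℤP.*-comm (+ d) (ℤ.- + s ℤ.+ + i))) (progression-≡ s α d s≤1 i 1≤i)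

  bound-≡ : ∀ s d k → s ≤ 1 → 1 ≤ k → + d ℤ.* (ℤ.- + s ℤ.+ + k ℤ.+ + 1) ≡ + (d ℕ.* (suc k ∸ s))
  bound-≡ s d k s≤1 1≤k = trans (cong (λ t → + d ℤ.* t) (trans (cong (λ t → t ℤ.+ + 1) (-[s]+i≡+[i∸s] s k s≤k)) (trans (sym (ℤP.pos-+ (k ∸ s) 1)) (cong +_ (trans (ℕP.+-comm (k ∸ s) 1) (sym (ℕP.+-∸-assoc 1 s≤k)))))))
                                (sym (ℤP.pos-* d (suc k ∸ s)))
    where
      s≤k = ℕP.≤-trans s≤1 1≤k

  prime∣top-factors : ∀ {p} → Prime p → ∀ T n k → p ∣ prodFromℕ T (n ∸ k ℕ.+ 1) (suc n ∸ (n ∸ k ℕ.+ 1)) →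
                      Σ ℕ λ i₀ → i₀ ≤ n × n < i₀ ℕ.+ k × p ∣ T i₀
  prime∣top-factors p-prime T n k p∣ with prime∣prodFromℕ p-prime T _ _ p∣
  ... | i₀ , lo≤i₀ , i₀<lo+c , p∣Tᵢ₀ = i₀ , i₀≤n , n<i₀+k , p∣Tᵢ₀
    where
      i₀≤n : i₀ ≤ n
      i₀≤n = ℕP.≤-pred (subst (i₀ <_) (ℕP.m+[n∸m]≡n (ℕP.≤-trans (ℕP.≤-reflexive (ℕP.+-comm (n ∸ k) 1)) (s≤s (ℕP.m∸n≤m n k)))) i₀<lo+c)
      n<i₀+k : n < i₀ ℕ.+ k
      n<i₀+k = ℕP.≤-trans (s≤s (ℕP.≤-trans (ℕP.m≤n+m∸n n k) (ℕP.≤-reflexive (ℕP.+-comm k (n ∸ k)))))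
                 (ℕP.≤-trans (ℕP.≤-reflexive (shift (n ∸ k) k)) (ℕP.+-monoˡ-≤ k lo≤i₀))
        where
          shift : ∀ x k → suc (x ℕ.+ k) ≡ x ℕ.+ 1 ℕ.+ k
          shift = solve-∀

  prime>P⇒∤ : ∀ {p} → Prime p → ∀ a₀ aₙ → a₀ ℤ.* aₙ ≢ + 0 → P (a₀ ℤ.* aₙ) < p →
              ¬ p ∣ ℤ.∣ a₀ ∣ × ¬ p ∣ ℤ.∣ aₙ ∣
  prime>P⇒∤ {p} p-prime a₀ aₙ a₀aₙ≢0 P<p = ∤ ℤ.∣ a₀ ∣ (∣-abs (m∣m*n ℤ.∣ aₙ ∣)) , ∤ ℤ.∣ aₙ ∣ (∣-abs (n∣m*n ℤ.∣ a₀ ∣))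
    where
      ∣-abs : ∀ {x} → x ∣ ℤ.∣ a₀ ∣ ℕ.* ℤ.∣ aₙ ∣ → x ∣ ℤ.∣ a₀ ℤ.* aₙ ∣
      ∣-abs = subst (_ ∣_) (sym (ℤP.abs-* a₀ aₙ))
      ∤ : ∀ z → z ∣ ℤ.∣ a₀ ℤ.* aₙ ∣ → ¬ p ∣ z
      ∤ z z∣ p∣z = ℕP.<-irrefl refl (ℕP.<-≤-trans P<p (prime∣⇒≤gpfBelow _ _ _ p-prime p∣ (∣⇒≤ {{ℕ.≢-nonZero ∣a₀aₙ∣≢0}} p∣)))
        where
          p∣ = ∣-trans p∣z z∣
          ∣a₀aₙ∣≢0 : ℤ.∣ a₀ ℤ.* aₙ ∣ ≢ 0
          ∣a₀aₙ∣≢0 eq = a₀aₙ≢0 (ℤP.∣i∣≡0⇒i≡0 eq)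

  -- Both statements are instances of the Newton polygon criterion:
  -- F = G_q with e = 1, and F = G_q(x^d) with e = d.
  no-factor-at-prime : ∀ {p} → Prime p → ∀ s → s ≤ 1 → ∀ d′ α n k i₀ (a : ℕ → ℤ) → 1 ≤ α → α < suc d′ → 1 ≤ k →
    a 0 ≢ + 0 → a n ≢ + 0 → ¬ p ∣ ℤ.∣ a 0 ∣ → ¬ p ∣ ℤ.∣ a n ∣ → suc d′ ℕ.* (suc k ∸ s) < p →
    i₀ ≤ n → n < i₀ ℕ.+ k → p ∣ progression s α (suc d′) i₀ →
    ¬ HasFactorOfDegree (Gq (ℤ.- + s) α (suc d′) n a) k
    × (∀ m → suc d′ ℕ.* k ∸ suc d′ ℕ.+ 1 ≤ m → m ≤ suc d′ ℕ.* k → ¬ HasFactorOfDegree (substXPow (suc d′) (Gq (ℤ.- + s) α (suc d′) n a)) m)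
  no-factor-at-prime {p} p-prime s s≤1 d′ α n k i₀ a 1≤α α<d 1≤k a₀≢0 aₙ≢0 p∤a₀ p∤aₙ D<p i₀≤n n<i₀+k p∣Tᵢ₀ =
    no-factor 1 ℕP.≤-refl G (support G Gq.c n Gq.coeff-Gq Gq.coeff-Gq->) (support-at G Gq.c n Gq.coeff-Gq Gq.coeff-Gq->)
      k 1*k∸1+1≤k (ℕP.≤-reflexive (sym (ℕP.*-identityˡ k))) ,
    no-factor d (s≤s z≤n) (substXPow d G) (substXPow-support G Gq.c n Gq.coeff-Gq Gq.coeff-Gq-> d′)
      (substXPow-support-at G Gq.c n Gq.coeff-Gq Gq.coeff-Gq-> d′)
    where
      d = suc d′
      G = Gq (ℤ.- + s) α d n a
      T = progression s α d
      T-pos : ∀ i → 1 ≤ i → 1 ≤ T i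
      T-pos i _ = progression-pos s α d 1≤α i
      module Gq = CoefficientValuation p p-prime (ℤ.- + s) α d n a T (progression-≡ s α d s≤1) T-pos
      T-small : ∀ j → 1 ≤ j → j ≤ k → T j < p
      T-small j 1≤j j≤k = ℕP.≤-<-trans (progression-≤-small α d k s≤1 (ℕP.<⇒≤ α<d) j 1≤j j≤k) D<p
      T-large : ∀ j → k ≤ j → k ℕ.* T j ≤ j ℕ.* (p ∸ 1)
      T-large j k≤j = ℕP.≤-trans (progression-≤-large α d k s≤1 (ℕP.<⇒≤ α<d) 1≤k j k≤j)
                                  (ℕP.*-monoʳ-≤ j (ℕP.≤-pred (ℕP.≤-trans D<p (ℕP.≤-reflexive (sym (ℕP.m+[n∸m]≡n (ℕP.≤-trans (s≤s z≤n) D<p)))))))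
      kν<j = Legendre.k*ν-prodFromℕ<j p p-prime T k 1≤k T-pos (progression-< α d s≤1 (s≤s z≤n)) T-small T-large
      1*k∸1+1≤k : 1 ℕ.* k ∸ 1 ℕ.+ 1 ≤ k
      1*k∸1+1≤k = ℕP.≤-reflexive (trans (cong (λ x → x ∸ 1 ℕ.+ 1) (ℕP.*-identityˡ k)) (ℕP.m∸n+n≡m 1≤k))
      no-factor : ∀ e → 1 ≤ e → (F : Poly) →
        (∀ N → (ℚ.↥ coeff F N ≡ ℤ.0ℤ) ⊎ (Σ ℕ λ j → (j ≤ n) × (N ≡ e ℕ.* j) × (coeff F N ≡ Gq.c j))) →
        (∀ j → j ≤ n → coeff F (e ℕ.* j) ≡ Gq.c j) →
        ∀ m → e ℕ.* k ∸ e ℕ.+ 1 ≤ m → m ≤ e ℕ.* k → ¬ HasFactorOfDegree F m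
      no-factor e 1≤e F F-support F-at = NewtonCriterion.no-factor-of-degree p p-prime e k n i₀ Gq.c F 1≤e 1≤k n<i₀+k
        F-support F-at (Gq.cₙ≢0 aₙ≢0) (Gq.ν-cₙ aₙ≢0 p∤aₙ) (Gq.ν-below-i₀ i₀ i₀≤n p∣Tᵢ₀) (Gq.c₀≢0 a₀≢0) (Gq.slope k a₀≢0 p∤a₀ kν<j)

  private
    d≤d*[1+k∸s] : ∀ {s} d k → s ≤ 1 → 1 ≤ k → d ≤ d ℕ.* (suc k ∸ s)
    d≤d*[1+k∸s] d k s≤1 1≤k = ℕP.m≤m*n d _ {{ℕ.>-nonZero (ℕP.≤-trans 1≤k (ℕP.∸-monoʳ-≤ (suc k) s≤1))}}

  progression-criterion : ∀ s → s ≤ 1 → (d α n k : ℕ) (a : ℕ → ℤ) → 1 ≤ d → 1 ≤ α → α < d → 0 < k →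
    a 0 ℤ.* a n ≢ + 0 → P (a 0 ℤ.* a n) ≤ d →
    + d ℤ.* (ℤ.- + s ℤ.+ + k ℤ.+ + 1) ℤ.< + P (prodRange (λ i → + α ℤ.+ + d ℤ.* (ℤ.- + s ℤ.+ + i)) (n ∸ k ℕ.+ 1) n) →
    ¬ HasFactorOfDegree (Gq (ℤ.- + s) α d n a) k
    × (∀ m → d ℕ.* k ∸ d ℕ.+ 1 ≤ m → m ≤ d ℕ.* k → ¬ HasFactorOfDegree (substXPow d (Gq (ℤ.- + s) α d n a)) m)
  progression-criterion s s≤1 d@(suc d′) α n k a _ 1≤α α<d 1≤k a₀aₙ≢0 P≤d D<P
    with large-prime-factor D Π (ℕP.≤-trans (s≤s z≤n) (d≤d*[1+k∸s] d k s≤1 1≤k)) D<gpf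
    where
      D = d ℕ.* (suc k ∸ s)
      Π = prodFromℕ (progression s α d) (n ∸ k ℕ.+ 1) (suc n ∸ (n ∸ k ℕ.+ 1))
      Π≡ : prodRange (λ i → + α ℤ.+ + d ℤ.* (ℤ.- + s ℤ.+ + i)) (n ∸ k ℕ.+ 1) n ≡ + Π
      Π≡ = prodFrom≡prodFromℕ _ (progression s α d) (progression-≡′ s α d s≤1) (n ∸ k ℕ.+ 1) (suc n ∸ (n ∸ k ℕ.+ 1)) (ℕP.m≤n+m 1 (n ∸ k))
      D<gpf : D < gpfBelow Π Π
      D<gpf = ℤP.drop‿+<+ (subst₂ (λ x y → x ℤ.< + P y) (bound-≡ s d k s≤1 1≤k) Π≡ D<P)
  ... | p , p-prime , p∣Π , D<p with prime∣top-factors p-prime (progression s α d) n k p∣Π | prime>P⇒∤ p-prime (a 0) (a n) a₀aₙ≢0 P<p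
    where
      P<p : P (a 0 ℤ.* a n) < p
      P<p = ℕP.≤-<-trans P≤d (ℕP.≤-<-trans (d≤d*[1+k∸s] d k s≤1 1≤k) D<p)
  ... | i₀ , i₀≤n , n<i₀+k , p∣Tᵢ₀ | p∤a₀ , p∤aₙ =
    no-factor-at-prime p-prime s s≤1 d′ α n k i₀ a 1≤α α<d 1≤k a₀≢0 aₙ≢0 p∤a₀ p∤aₙ D<p i₀≤n n<i₀+k p∣Tᵢ₀
    where
      a₀≢0 : a 0 ≢ + 0
      a₀≢0 a₀≡0 = a₀aₙ≢0 (cong (ℤ._* a n) a₀≡0)
      aₙ≢0 : a n ≢ + 0
      aₙ≢0 aₙ≡0 = a₀aₙ≢0 (trans (cong (a 0 ℤ.*_) aₙ≡0) (ℤP.*-zeroʳ (a 0)))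

open Progression using (progression-criterion)
open import Data.Nat as ℕ using (ℕ; _≤_; _<_; _∸_; z≤n; s≤s)
open import Data.Nat.Properties using (<⇒≤)
open import Data.Nat.GCD using (gcd)
open import Data.Integer as ℤ using (ℤ; +_; -[1+_])
open import Data.Product using (_×_)
open import Data.Sum using (_⊎_; inj₁; inj₂)
open import Relation.Nullary using (¬_)
open import Relation.Binary.PropositionalEquality using (_≡_; _≢_; refl)

corollary3 : (d : ℕ) (u : ℤ) (α : ℕ) (n k : ℕ) (a : ℕ → ℤ) →
    2 ≤ d → (u ≡ + 0 ⊎ u ≡ -[1+ 0 ]) → 1 ≤ α → α < d → gcd α d ≡ 1 →
    0 < k → 2 ℕ.* k ≤ n →
    a 0 ℤ.* a n ≢ + 0 →
    P (a 0 ℤ.* a n) ≤ d →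
    + d ℤ.* (u ℤ.+ + k ℤ.+ + 1) ℤ.<
      + P (prodRange (λ i → + α ℤ.+ + d ℤ.* (u ℤ.+ + i)) (n ∸ k ℕ.+ 1) n) →
    ¬ HasFactorOfDegree (Gq u α d n a) k
    × (∀ m → d ℕ.* k ∸ d ℕ.+ 1 ≤ m → m ≤ d ℕ.* k →
         ¬ HasFactorOfDegree (substXPow d (Gq u α d n a)) m)
corollary3 d u α n k a 2≤d (inj₁ refl) 1≤α α<d _ 0<k _ =
  progression-criterion 0 z≤n d α n k a (<⇒≤ 2≤d) 1≤α α<d 0<k
corollary3 d u α n k a 2≤d (inj₂ refl) 1≤α α<d _ 0<k _ =
  progression-criterion 1 (s≤s z≤n) d α n k a (<⇒≤ 2≤d) 1≤α α<d 0<k
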